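{- For each $\mathsf{PROP}$ $\mathcal S$ there is an isomorphism of $\mathsf{PROP}$s $\mathcal S\to\mathit{ORD}(\mathit{NOM}(\mathcal S))$, natural in $\mathcal S$, mapping $f:\underline n\to\underline m$ in $\mathcal S$ to $\langle\boldsymbol a][\boldsymbol a\rangle f\langle\boldsymbol b][\boldsymbol b\rangle$ for some choice of lists $\boldsymbol a,\boldsymbol b$ of pairwise distinct names of lengths $n,m$.
   Context: $\mathcal N$ is a countably infinite set of names; bold letters denote lists of pairwise distinct names, $\underline{\boldsymbol a}$ the set of entries, $+$ concatenation. A $\mathsf{PROP}$ (MacLane) is a symmetric strict monoidal category with objects the natural numbers $\underline n$, tensor $\oplus$ addition on objects, composition $;$ (diagrammatic), satisfying the symmetric strict monoidal laws including naturality of symmetries; morphisms of $\mathsf{PROP}$s are identity-on-objects strict symmetric monoidal functors. $\langle\boldsymbol a|\boldsymbol a'\rangle$ (with $\underline{\boldsymbol a}=\underline{\boldsymbol a'}$) is the symmetry mapping $i\mapsto j$ where $a_i=a'_j$. A nominal $\mathsf{PROP}$ is a small category with objects finite subsets of $\mathcal N$, partial commutative associative tensor $\uplus$ (disjoint union; on arrows defined iff domains disjoint and codomains disjoint), unit $\emptyset$, interchange whenever both sides defined, containing all bijections $\pi_A:A\to\pi[A]$, with permutation action $\pi\cdot f=(\pi_A)^{ -1};f;\pi_B$; morphisms are identity-on-objects strict monoidal equivariant functors. $[\boldsymbol a|\boldsymbol b]=\biguplus_i\delta_{a_ib_i}$ with $\delta_{ab}:\{a\}\to\{b\}$. $\mathit{NOM}(\mathcal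 S)$ is the nominal $\mathsf{PROP}$ with arrows $[\boldsymbol a\rangle f\langle\boldsymbol b]:\underline{\boldsymbol a}\to\underline{\boldsymbol b}$ ($f:\underline n\to\underline m$ in $\mathcal S$, $|\boldsymbol a|=n$, $|\boldsymbol b|=m$) subject to $[\boldsymbol a\rangle f;g\langle\boldsymbol c]=[\boldsymbol a\rangle f\langle\boldsymbol b];[\boldsymbol b\rangle g\langle\boldsymbol c]$, $[\boldsymbol a+\boldsymbol c\rangle f\oplus g\langle\boldsymbol b+\boldsymbol d]=[\boldsymbol a\rangle f\langle\boldsymbol b]\uplus[\boldsymbol c\rangle g\langle\boldsymbol d]$, $[\boldsymbol a\rangle\mathit{id}\langle\boldsymbol b]=[\boldsymbol a|\boldsymbol b]$, $[\boldsymbol a\rangle\langle\boldsymbol b|\boldsymbol b'\rangle;f\langle\boldsymbol c]=[\boldsymbol a|\boldsymbol b];[\boldsymbol b'\rangle f\langle\boldsymbol c]$, $[\boldsymbol a\rangle f;\langle\boldsymbol b|\boldsymbol b'\rangle\langle\boldsymbol c]=[\boldsymbol a\rangle f\langle\boldsymbol b];[\boldsymbol b'|\boldsymbol c]$. For a nominal $\mathsf{PROP}$ $\mathcal T$, $\mathit{ORD}(\mathcal T)$ is the $\mathsf{PROP}$ with arrows $\langle\boldsymbol a]f[\boldsymbol b\rangle:\underline n\to\underline m$ ($f:A\to B$ in $\mathcal T$, $\boldsymbol a,\boldsymbol b$ enumerating $A,B$) subject to $\langle\boldsymbol a]f;g[\boldsymbol c\rangle=\langle\boldsymbol a]f[\boldsymbol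 b\rangle;\langle\boldsymbol b]g[\boldsymbol c\rangle$, $\langle\boldsymbol a_f+\boldsymbol a_g]f\uplus g[\boldsymbol b_f+\boldsymbol b_g\rangle=\langle\boldsymbol a_f]f[\boldsymbol b_f\rangle\oplus\langle\boldsymbol a_g]g[\boldsymbol b_g\rangle$, $\langle\boldsymbol a]\mathit{id}[\boldsymbol a\rangle=\mathit{id}$, $\langle\boldsymbol a][\boldsymbol a'|\boldsymbol b];f[\boldsymbol c\rangle=\langle\boldsymbol a|\boldsymbol a'\rangle;\langle\boldsymbol b]f[\boldsymbol c\rangle$, $\langle\boldsymbol a]f;[\boldsymbol b|\boldsymbol c][\boldsymbol c'\rangle=\langle\boldsymbol a]f[\boldsymbol b\rangle;\langle\boldsymbol c|\boldsymbol c'\rangle$. $\mathit{NOM}$ and $\mathit{ORD}$ act on morphisms by $\mathit{NOM}(F)([\boldsymbol a\rangle g\langle\boldsymbol b])=[\boldsymbol a\rangle Fg\langle\boldsymbol b]$ and $\mathit{ORD}(F)(\langle\boldsymbol a]f[\boldsymbol b\rangle)=\langle\boldsymbol a]Ff[\boldsymbol b\rangle$. -}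

module Defs where

open import Level using (Level; _⊔_) renaming (suc to lsuc)
open import Data.Nat using (ℕ; zero; suc; _+_)
open import Data.Nat.Properties using (+-assoc; +-identityʳ; +-suc; +-comm)
open import Data.Bool using (Bool; true; false; _∨_; T; if_then_else_)
open import Data.Bool.Properties using (∨-assoc)
open import Data.Empty using (⊥; ⊥-elim)
open import Data.Unit using (tt)
open import Data.Fin using (Fin; zero; suc)
open import Data.Maybe using (Maybe; just; nothing)
import Data.Maybe as Maybe
open import Data.Vec using (Vec; []; _∷_; _++_; map; removeAt)
open import Data.Product using (Σ; _×_; _,_; proj₁; proj₂)
open import Relation.Binary using (Rel; IsEquivalence)
open import Relation.Binary.PropositionalEquality
  using (_≡_; refl; sym; trans; cong; cong₂; subst; subst₂)
import Data.Nat as ℕ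

-- Names are natural numbers (a countably infinite set).
-- Finite sets of names, in a canonical representation so that
-- propositional equality is equality of sets:
--   one      = {0}
--   b ∷ᵇ s   = (if b then {0} else ∅) ∪ { x+1 | x ∈ s }
-- Every non-empty finite subset of ℕ has exactly one NE code.

infixr 5 _∷ᵇ_
data NE : Set where
  one  : NE
  _∷ᵇ_ : Bool → NE → NE

data FinSet : Set where
  ∅  : FinSet
  ne : NE → FinSet

memN : ℕ → NE → Bool
memN zero    one      = true
memN (suc x) one      = false
memN zero    (b ∷ᵇ s) = b
memN (suc x) (b ∷ᵇ s) = memN x s

_∈ₛ_ : ℕ → FinSet → Set
x ∈ₛ ∅    = ⊥
x ∈ₛ ne s = T (memN x s)

Disjoint : FinSet → FinSet → Set
Disjoint A C = ∀ x → x ∈ₛ A → x ∈ₛ C → ⊥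

_∪ₙ_ : NE → NE → NE
one      ∪ₙ one      = one
one      ∪ₙ (b ∷ᵇ t) = true ∷ᵇ t
(b ∷ᵇ s) ∪ₙ one      = true ∷ᵇ s
(b ∷ᵇ s) ∪ₙ (c ∷ᵇ t) = (b ∨ c) ∷ᵇ (s ∪ₙ t)

-- union (the object part of the partial tensor ⊎, used on disjoint sets)
_∪_ : FinSet → FinSet → FinSet
∅    ∪ B    = B
ne s ∪ ∅    = ne s
ne s ∪ ne t = ne (s ∪ₙ t)

cardN : NE → ℕ
cardN one          = 1
cardN (true ∷ᵇ s)  = suc (cardN s)
cardN (false ∷ᵇ s) = cardN s

card : FinSet → ℕ
card ∅      = 0
card (ne s) = cardN s

singleN : ℕ → NE
singleN zero    = one
singleN (suc x) = false ∷ᵇ singleN x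

set : ∀ {n} → Vec ℕ n → FinSet
set []       = ∅
set (x ∷ xs) = ne (singleN x) ∪ set xs

-- "a enumerates A": the entries of a form A and a has |A| entries
-- (equivalently: a is a list of pairwise distinct names with set A).
Enum : ∀ {n} → Vec ℕ n → FinSet → Set
Enum {n} a A = (set a ≡ A) × (n ≡ card A)

enumN : (s : NE) → Vec ℕ (cardN s)
enumN one          = 0 ∷ []
enumN (true ∷ᵇ s)  = 0 ∷ map suc (enumN s)
enumN (false ∷ᵇ s) = map suc (enumN s)

enum : (A : FinSet) → Vec ℕ (card A)
enum ∅      = []
enum (ne s) = enumN s

∪ₙ-assoc : ∀ s t u → (s ∪ₙ t) ∪ₙ u ≡ s ∪ₙ (t ∪ₙ u)
∪ₙ-assoc one one one = refl
∪ₙ-assoc one one (c ∷ᵇ u) = refl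
∪ₙ-assoc one (b ∷ᵇ t) one = refl
∪ₙ-assoc one (b ∷ᵇ t) (c ∷ᵇ u) = refl
∪ₙ-assoc (a ∷ᵇ s) one one = refl
∪ₙ-assoc (true ∷ᵇ s) one (c ∷ᵇ u) = refl
∪ₙ-assoc (false ∷ᵇ s) one (c ∷ᵇ u) = refl
∪ₙ-assoc (true ∷ᵇ s) (b ∷ᵇ t) one = refl
∪ₙ-assoc (false ∷ᵇ s) (b ∷ᵇ t) one = refl
∪ₙ-assoc (a ∷ᵇ s) (b ∷ᵇ t) (c ∷ᵇ u) = cong₂ _∷ᵇ_ (∨-assoc a b c) (∪ₙ-assoc s t u)

∪-assoc : ∀ A B C → (A ∪ B) ∪ C ≡ A ∪ (B ∪ C)
∪-assoc ∅ B C = refl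
∪-assoc (ne s) ∅ C = refl
∪-assoc (ne s) (ne t) ∅ = refl
∪-assoc (ne s) (ne t) (ne u) = cong ne (∪ₙ-assoc s t u)

set-++ : ∀ {n p} (a : Vec ℕ n) (c : Vec ℕ p) → set (a ++ c) ≡ set a ∪ set c
set-++ [] c = refl
set-++ (x ∷ a) c = trans (cong (ne (singleN x) ∪_) (set-++ a c))
                         (sym (∪-assoc (ne (singleN x)) (set a) (set c)))

cardN-∪ : ∀ s t → (∀ x → T (memN x s) → T (memN x t) → ⊥) →
          cardN (s ∪ₙ t) ≡ cardN s + cardN t
cardN-∪ one one d = ⊥-elim (d 0 tt tt)
cardN-∪ one (true ∷ᵇ t) d = ⊥-elim (d 0 tt tt)
cardN-∪ one (false ∷ᵇ t) d = refl
cardN-∪ (true ∷ᵇ s) one d = ⊥-elim (d 0 tt tt)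
cardN-∪ (false ∷ᵇ s) one d = +-comm 1 (cardN s)
cardN-∪ (true ∷ᵇ s) (true ∷ᵇ t) d = ⊥-elim (d 0 tt tt)
cardN-∪ (true ∷ᵇ s) (false ∷ᵇ t) d = cong suc (cardN-∪ s t (λ x → d (suc x)))
cardN-∪ (false ∷ᵇ s) (true ∷ᵇ t) d =
  trans (cong suc (cardN-∪ s t (λ x → d (suc x)))) (sym (+-suc (cardN s) (cardN t)))
cardN-∪ (false ∷ᵇ s) (false ∷ᵇ t) d = cardN-∪ s t (λ x → d (suc x))

card-∪ : ∀ A C → Disjoint A C → card (A ∪ C) ≡ card A + card C
card-∪ ∅ C d = refl
card-∪ (ne s) ∅ d = sym (+-identityʳ (cardN s))
card-∪ (ne s) (ne t) d = cardN-∪ s t d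

shift : FinSet → FinSet
shift ∅      = ∅
shift (ne s) = ne (false ∷ᵇ s)

single-shift : ∀ x S → ne (singleN (suc x)) ∪ shift S ≡ shift (ne (singleN x) ∪ S)
single-shift x ∅ = refl
single-shift x (ne s) = refl

set-map-suc : ∀ {n} (v : Vec ℕ n) → set (map suc v) ≡ shift (set v)
set-map-suc [] = refl
set-map-suc (x ∷ v) = trans (cong (ne (singleN (suc x)) ∪_) (set-map-suc v))
                            (single-shift x (set v))

set-enumN : ∀ s → set (enumN s) ≡ ne s
set-enumN one = refl
set-enumN (true ∷ᵇ s) =
  trans (cong (ne one ∪_) (set-map-suc (enumN s)))
        (cong (λ X → ne one ∪ shift X) (set-enumN s))
set-enumN (false ∷ᵇ s) =
  trans (set-map-suc (enumN s)) (cong shift (set-enumN s))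

enum-Enum : (A : FinSet) → Enum (enum A) A
enum-Enum ∅      = refl , refl
enum-Enum (ne s) = set-enumN s , refl

Enum-++ : ∀ {n p A C} {a : Vec ℕ n} {c : Vec ℕ p} → Disjoint A C →
          Enum a A → Enum c C → Enum (a ++ c) (A ∪ C)
Enum-++ {n} {p} {A} {C} {a} {c} d (sa , na) (sc , nc) =
  trans (set-++ a c) (cong₂ _∪_ sa sc) ,
  trans (cong₂ _+_ na nc) (sym (card-∪ A C d))

record PROP (c ℓ : Level) : Set (lsuc (c ⊔ ℓ)) where
  infixr 9 _⨾_
  infixr 10 _⊕_
  infix 4 _≈_
  field
    Hom    : ℕ → ℕ → Set c
    _≈_    : ∀ {m n} → Rel (Hom m n) ℓ
    ≈-equiv : ∀ {m n} → IsEquivalence (_≈_ {m} {n})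
    id     : ∀ n → Hom n n
    _⨾_    : ∀ {l m n} → Hom l m → Hom m n → Hom l n
    _⊕_    : ∀ {m n p q} → Hom m n → Hom p q → Hom (m + p) (n + q)
    σ      : ∀ m n → Hom (m + n) (n + m)
    ⨾-cong : ∀ {l m n} {f f' : Hom l m} {g g' : Hom m n} →
             f ≈ f' → g ≈ g' → f ⨾ g ≈ f' ⨾ g'
    idˡ    : ∀ {m n} (f : Hom m n) → id m ⨾ f ≈ f
    idʳ    : ∀ {m n} (f : Hom m n) → f ⨾ id n ≈ f
    assoc  : ∀ {k l m n} (f : Hom k l) (g : Hom l m) (h : Hom m n) →
             (f ⨾ g) ⨾ h ≈ f ⨾ (g ⨾ h)
    ⊕-cong : ∀ {m n p q} {f f' : Hom m n} {g g' : Hom p q} →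
             f ≈ f' → g ≈ g' → f ⊕ g ≈ f' ⊕ g'
    ⊕-id   : ∀ m n → id m ⊕ id n ≈ id (m + n)
    ⊕-⨾    : ∀ {m n k p q r} (f : Hom m n) (g : Hom n k) (f' : Hom p q) (g' : Hom q r) →
             (f ⨾ g) ⊕ (f' ⨾ g') ≈ (f ⊕ f') ⨾ (g ⊕ g')
    ⊕-assoc : ∀ {m n p q r s} (f : Hom m n) (g : Hom p q) (h : Hom r s) →
              subst₂ Hom (+-assoc m p r) (+-assoc n q s) ((f ⊕ g) ⊕ h) ≈ f ⊕ (g ⊕ h)
    ⊕-unitˡ : ∀ {m n} (f : Hom m n) → id 0 ⊕ f ≈ f
    ⊕-unitʳ : ∀ {m n} (f : Hom m n) →
              subst₂ Hom (+-identityʳ m) (+-identityʳ n) (f ⊕ id 0) ≈ f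
    σ-inv  : ∀ m n → σ m n ⨾ σ n m ≈ id (m + n)
    σ-nat  : ∀ {m n p q} (f : Hom m n) (g : Hom p q) →
             (f ⊕ g) ⨾ σ n q ≈ σ m p ⨾ (g ⊕ f)
    σ-hex  : ∀ m n k →
             σ (m + n) k ≈
             subst (λ x → Hom x (k + (m + n))) (sym (+-assoc m n k))
               ((id m ⊕ σ n k) ⨾
                subst₂ Hom (+-assoc m k n) (+-assoc k m n) (σ m k ⊕ id n))

record IsPROPMorphism {c ℓ c' ℓ'} (S : PROP c ℓ) (S' : PROP c' ℓ')
       (F : ∀ {m n} → PROP.Hom S m n → PROP.Hom S' m n) : Set (c ⊔ ℓ ⊔ ℓ') where
  private
    module S  = PROP S
    module S' = PROP S'
  field
    F-cong : ∀ {m n} {f g : S.Hom m n} → f S.≈ g → F f S'.≈ F g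
    F-id   : ∀ n → F (S.id n) S'.≈ S'.id n
    F-⨾    : ∀ {l m n} (f : S.Hom l m) (g : S.Hom m n) → F (f S.⨾ g) S'.≈ F f S'.⨾ F g
    F-⊕    : ∀ {m n p q} (f : S.Hom m n) (g : S.Hom p q) → F (f S.⊕ g) S'.≈ F f S'.⊕ F g
    F-σ    : ∀ m n → F (S.σ m n) S'.≈ S'.σ m n

-- Symmetries ⟨a|a'⟩ in a PROP, built from σ, ⊕, ⨾:
-- ⟨a|a'⟩ maps position i to position j where a_i = a'_j
-- (meaningful when the entries of a and a' coincide).

module Symmetries {c ℓ} (S : PROP c ℓ) where
  open PROP S

  -- moves wire 0 to position k, shifting wires 1..k down by one
  ins : ∀ {n} → Fin (suc n) → Hom (suc n) (suc n)
  ins {n}     zero    = id (suc n)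
  ins {suc n} (suc k) = (σ 1 1 ⊕ id n) ⨾ (id 1 ⊕ ins k)

  findIdx : ∀ {n} → ℕ → Vec ℕ n → Maybe (Fin n)
  findIdx x []       = nothing
  findIdx x (y ∷ ys) = if x ℕ.≡ᵇ y then just zero else Maybe.map suc (findIdx x ys)

  ⟨_∣_⟩ : ∀ {n} → Vec ℕ n → Vec ℕ n → Hom n n
  ⟨ [] ∣ [] ⟩ = id 0
  ⟨_∣_⟩ {suc n} (x ∷ as) a' with findIdx x a'
  ... | just k  = (id 1 ⊕ ⟨ as ∣ removeAt a' k ⟩) ⨾ ins k
  ... | nothing = id (suc n)

-- Objects: finite sets of
-- names; partial tensor ⊎ defined on arrows with disjoint domains and
-- disjoint codomains; bijections [a|b] : A → B (a enumerating A,
-- b enumerating B, mapping a_i ↦ b_i).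

record NomPROP (c ℓ : Level) : Set (lsuc (c ⊔ ℓ)) where
  infixr 9 _⨾_
  infix 4 _≈_
  field
    Hom    : FinSet → FinSet → Set c
    _≈_    : ∀ {A B} → Rel (Hom A B) ℓ
    ≈-equiv : ∀ {A B} → IsEquivalence (_≈_ {A} {B})
    id     : ∀ A → Hom A A
    _⨾_    : ∀ {A B C} → Hom A B → Hom B C → Hom A C
    tensor : ∀ {A B C D} → Hom A B → Hom C D → Disjoint A C → Disjoint B D →
             Hom (A ∪ C) (B ∪ D)
    [_∣_]  : ∀ {n A B} (a b : Vec ℕ n) → Enum a A → Enum b B → Hom A B

module _ {c ℓ} (S : PROP c ℓ) where
  private module S = PROP S
  open Symmetries S

  record NOMHom (A B : FinSet) : Set c where
    constructor [_⟩_⟨_]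
    field
      {n m} : ℕ
      a  : Vec ℕ n
      f  : S.Hom n m
      b  : Vec ℕ m
      {ea} : Enum a A
      {eb} : Enum b B

  -- equality of NOM(S)-arrows: generated by equality in S and the
  -- re-indexing equations
  --   [a⟩⟨a|a'⟩;f⟨b] = [a'⟩f⟨b]      (eq. 4 with b := a)
  --   [a⟩f;⟨b|b'⟩⟨b'] = [a⟩f⟨b]      (eq. 5 with c := b')
  data NOM≈ {A B : FinSet} : NOMHom A B → NOMHom A B → Set (c ⊔ ℓ) where
    nom-mid  : ∀ {n m} {a : Vec ℕ n} {b : Vec ℕ m} {f g : S.Hom n m} {ea ea' eb eb'} →
               f S.≈ g → NOM≈ ([ a ⟩ f ⟨ b ] {ea} {eb}) ([ a ⟩ g ⟨ b ] {ea'} {eb'})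
    nom-permL : ∀ {n m} {a a' : Vec ℕ n} {b : Vec ℕ m} {f : S.Hom n m} {ea ea' eb eb'} →
               NOM≈ ([ a ⟩ ⟨ a ∣ a' ⟩ S.⨾ f ⟨ b ] {ea} {eb}) ([ a' ⟩ f ⟨ b ] {ea'} {eb'})
    nom-permR : ∀ {n m} {a : Vec ℕ n} {b b' : Vec ℕ m} {f : S.Hom n m} {ea ea' eb eb'} →
               NOM≈ ([ a ⟩ f S.⨾ ⟨ b ∣ b' ⟩ ⟨ b' ] {ea} {eb}) ([ a ⟩ f ⟨ b ] {ea'} {eb'})
    nom-refl  : ∀ {x} → NOM≈ x x
    nom-sym   : ∀ {x y} → NOM≈ x y → NOM≈ y x
    nom-trans : ∀ {x y z} → NOM≈ x y → NOM≈ y z → NOM≈ x z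

  private
    nomComp : ∀ {A B C} → NOMHom A B → NOMHom B C → NOMHom A C
    nomComp ([ a ⟩ f ⟨ b ] {ea} {eb}) ([ b' ⟩ g ⟨ c ] {eb'} {ec}) =
      [ a ⟩ f S.⨾ (⟨ b ∣ subst (Vec ℕ) (sym p) b' ⟩ S.⨾
                   subst (λ x → S.Hom x _) (sym p) g) ⟨ c ] {ea} {ec}
      where p = trans (proj₂ eb) (sym (proj₂ eb'))

    nomTensor : ∀ {A B C D} → NOMHom A B → NOMHom C D → Disjoint A C → Disjoint B D →
                NOMHom (A ∪ C) (B ∪ D)
    nomTensor ([ a ⟩ f ⟨ b ] {ea} {eb}) ([ c ⟩ g ⟨ d ] {ec} {ed}) dAC dBD =
      [ a ++ c ⟩ f S.⊕ g ⟨ b ++ d ] {Enum-++ {a = a} {c = c} dAC ea ec} {Enum-++ {a = b} {c = d} dBD eb ed}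

  NOM : NomPROP c (c ⊔ ℓ)
  NOM = record
    { Hom     = NOMHom
    ; _≈_     = NOM≈
    ; ≈-equiv = record { refl = nom-refl ; sym = nom-sym ; trans = nom-trans }
    ; id      = λ A → [ enum A ⟩ S.id (card A) ⟨ enum A ] {enum-Enum A} {enum-Enum A}
    ; _⨾_     = nomComp
    ; tensor  = nomTensor
    ; [_∣_]   = λ a b ea eb → [ a ⟩ S.id _ ⟨ b ] {ea} {eb}
    }

NOM₁ : ∀ {c ℓ c' ℓ'} {S : PROP c ℓ} {S' : PROP c' ℓ'} →
       (∀ {m n} → PROP.Hom S m n → PROP.Hom S' m n) →
       ∀ {A B} → NOMHom S A B → NOMHom S' A B
NOM₁ F ([ a ⟩ g ⟨ b ] {ea} {eb}) = [ a ⟩ F g ⟨ b ] {ea} {eb}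

module _ {c ℓ} (T : NomPROP c ℓ) where
  private module T = NomPROP T

  record ORDHom (n m : ℕ) : Set c where
    constructor ⟨_]_[_⟩
    field
      {A B} : FinSet
      a  : Vec ℕ n
      f  : T.Hom A B
      b  : Vec ℕ m
      {ea} : Enum a A
      {eb} : Enum b B

  -- equality of ORD(T)-arrows: generated by equality in T and
  --   ⟨a][a|b];f[c⟩ = ⟨b]f[c⟩        (eq. 4 with a' := a)
  --   ⟨a]f;[b|c][c⟩ = ⟨a]f[b⟩        (eq. 5 with c' := c)
  data ORD≈ {n m : ℕ} : ORDHom n m → ORDHom n m → Set (c ⊔ ℓ) where
    ord-mid : ∀ {A B} {a : Vec ℕ n} {b : Vec ℕ m} {f g : T.Hom A B} {ea ea' eb eb'} →
              f T.≈ g → ORD≈ (⟨ a ] f [ b ⟩ {ea} {eb}) (⟨ a ] g [ b ⟩ {ea'} {eb'})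
    ord-moveL : ∀ {A B C} {a b : Vec ℕ n} {c : Vec ℕ m} {f : T.Hom B C}
                  {ea : Enum a A} {eb : Enum b B} {ea' eb' ec ec'} →
              ORD≈ (⟨ a ] T.[ a ∣ b ] ea eb T.⨾ f [ c ⟩ {ea'} {ec})
                   (⟨ b ] f [ c ⟩ {eb'} {ec'})
    ord-moveR : ∀ {A B C} {a : Vec ℕ n} {b c : Vec ℕ m} {f : T.Hom A B}
                  {eb : Enum b B} {ec : Enum c C} {ea ea' eb' ec'} →
              ORD≈ (⟨ a ] f T.⨾ T.[ b ∣ c ] eb ec [ c ⟩ {ea} {ec'})
                   (⟨ a ] f [ b ⟩ {ea'} {eb'})
    ord-refl  : ∀ {x} → ORD≈ x x
    ord-sym   : ∀ {x y} → ORD≈ x y → ORD≈ y x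
    ord-trans : ∀ {x y z} → ORD≈ x y → ORD≈ y z → ORD≈ x z

  -- The operations of ORD(T) are given by
  -- the defining equations (1), (2), (3) and the symmetries; each is
  -- stated for arbitrary representatives (they exist for every pair of
  -- arrows by renaming).  Isomorphism = structure-preserving bijection
  -- on every hom-setoid (the inverse of such a map is automatically a
  -- morphism of PROPs).
  record IsPROPIsoToORD {c₀ ℓ₀} (S : PROP c₀ ℓ₀)
         (η : ∀ {n m} → PROP.Hom S n m → ORDHom n m) : Set (c₀ ⊔ ℓ₀ ⊔ c ⊔ ℓ) where
    private module S = PROP S
    field
      η-cong : ∀ {n m} {f g : S.Hom n m} → f S.≈ g → ORD≈ (η f) (η g)
      η-injective  : ∀ {n m} {f g : S.Hom n m} → ORD≈ (η f) (η g) → f S.≈ g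
      η-surjective : ∀ {n m} (h : ORDHom n m) → Σ (S.Hom n m) λ f → ORD≈ (η f) h
      η-id : ∀ n {A} (a : Vec ℕ n) (ea : Enum a A) →
             ORD≈ (η (S.id n)) (⟨ a ] T.id A [ a ⟩ {ea} {ea})
      η-⨾ : ∀ {l m n} (f : S.Hom l m) (g : S.Hom m n) {A B C}
              (a : Vec ℕ l) (b : Vec ℕ m) (c : Vec ℕ n)
              (f' : T.Hom A B) (g' : T.Hom B C) {ea eb eb' ec} →
            ORD≈ (η f) (⟨ a ] f' [ b ⟩ {ea} {eb}) →
            ORD≈ (η g) (⟨ b ] g' [ c ⟩ {eb'} {ec}) →
            ORD≈ (η (f S.⨾ g)) (⟨ a ] f' T.⨾ g' [ c ⟩ {ea} {ec})
      η-⊕ : ∀ {m n p q} (f : S.Hom m n) (g : S.Hom p q) {A B C D}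
              (a : Vec ℕ m) (b : Vec ℕ n) (c : Vec ℕ p) (d : Vec ℕ q)
              (f' : T.Hom A B) (g' : T.Hom C D)
              (dAC : Disjoint A C) (dBD : Disjoint B D) {ea eb ec ed eac ebd} →
            ORD≈ (η f) (⟨ a ] f' [ b ⟩ {ea} {eb}) →
            ORD≈ (η g) (⟨ c ] g' [ d ⟩ {ec} {ed}) →
            ORD≈ (η (f S.⊕ g)) (⟨ a ++ c ] T.tensor f' g' dAC dBD [ b ++ d ⟩ {eac} {ebd})
      η-σ : ∀ m n {A} (a : Vec ℕ m) (c : Vec ℕ n) {e e'} →
            ORD≈ (η (S.σ m n)) (⟨ a ++ c ] T.id A [ c ++ a ⟩ {e} {e'})

ORD₁ : ∀ {c ℓ c' ℓ'} {T : NomPROP c ℓ} {T' : NomPROP c' ℓ'} →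
       (∀ {A B} → NomPROP.Hom T A B → NomPROP.Hom T' A B) →
       ∀ {n m} → ORDHom T n m → ORDHom T' n m
ORD₁ F (⟨ a ] f [ b ⟩ {ea} {eb}) = ⟨ a ] F f [ b ⟩ {ea} {eb}

-- η f := ⟨c][c⟩f⟨c′][c′⟩ with the standard names c = 0,…,n-1 and c′ = 0,…,m-1. Its inverse
-- sends ⟨a][a₁⟩g⟨b₁][b⟩ to ⟨a|a₁⟩ ; g ; ⟨b₁|b⟩ in S, where a, a₁ enumerate one set and b₁, b
-- another. That this is well defined on ORD(NOM(S)) and that η preserves ;, ⊕, id and σ all
-- reduce to four laws for the symmetries ⟨u|v⟩ between enumerations of the same set:
--   ⟨v|v⟩ = id,  ⟨u|v⟩ ; ⟨v|w⟩ = ⟨u|w⟩,  ⟨a|a′⟩ ⊕ ⟨c|c′⟩ = ⟨a+c|a′+c′⟩,  σ_{m,n} = ⟨u+v|v+u⟩.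
-- They are proved by induction on the lists, unfolding ⟨x∷u|w⟩ = (id₁ ⊕ ⟨u|w∖x⟩) ; ins_k with k
-- the position of x in w. The symmetric structure of S enters through the braid relation for
-- σ_{1,1}, which lets two successive insertions be exchanged, and through the hexagon law, which
-- decomposes σ_{m,n} into insertions.

module Submission where

open import Defs
open import Level using (Level)
open import Data.Nat using (ℕ; zero; suc; _+_; _≤_; z≤n; s≤s; _≡ᵇ_; _≟_)
open import Data.Nat.Properties
  using (≡ᵇ⇒≡; ≡⇒≡ᵇ; ≡-irrelevant; suc-injective; +-assoc; +-identityʳ; +-comm; ≤-trans; n≤1+n; 1+n≰n; ≤-reflexive)
open import Data.Bool using (true; false; T; _∨_; if_then_else_)
open import Data.Bool.Properties using (T?; T-≡; T-∨; ∨-identityʳ)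
open import Data.Empty using (⊥; ⊥-elim)
open import Data.Fin using (Fin; zero; suc; _↑ˡ_; fromℕ; punchIn; pinch)
open import Data.Maybe using (Maybe; just; nothing)
import Data.Maybe as Maybe
open import Data.Maybe.Properties using (just-injective)
open import Data.Product using (Σ; _×_; _,_; proj₁; proj₂)
open import Data.Sum using (_⊎_; inj₁; inj₂; [_,_]′)
open import Data.Vec using (Vec; []; _∷_; _++_; map; removeAt; _∷ʳ_; [_]; cast)
open import Data.Vec.Properties
  using (subst-is-cast; cast-sym; ++-identityʳ-eqFree; unfold-∷ʳ-eqFree; ++-assoc-eqFree)
open import Data.Vec.Membership.Propositional using (_∈_)
open import Data.Vec.Relation.Unary.Any using (here; there)
import Data.Vec.Relation.Unary.Any.Properties as Any
open import Function using (_∘_)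
open import Function.Bundles using (Equivalence)
open import Relation.Nullary using (¬_; Dec; yes; no)
open import Relation.Binary.Bundles using (Setoid)
open import Relation.Binary.Structures using (IsEquivalence)
import Relation.Binary.Reasoning.Setoid as SetoidReasoning
open import Relation.Binary.PropositionalEquality
  using (_≡_; _≢_; refl; sym; trans; cong; cong₂; subst; subst₂; module ≡-Reasoning)

module NameLists where

  data Distinct : ∀ {n} → Vec ℕ n → Set where
    []  : Distinct []
    _∷_ : ∀ {n x} {xs : Vec ℕ n} → ¬ x ∈ xs → Distinct xs → Distinct (x ∷ xs)

  infix 4 _⊆_
  _⊆_ : ∀ {n m} → Vec ℕ n → Vec ℕ m → Set
  u ⊆ v = ∀ {z} → z ∈ u → z ∈ v

  indexOf : ∀ {n} → ℕ → Vec ℕ n → Maybe (Fin n)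
  indexOf x []       = nothing
  indexOf x (y ∷ ys) = if x ≡ᵇ y then just zero else Maybe.map suc (indexOf x ys)

  -- Removes the first occurrence of x; if x does not occur, the last entry is dropped.
  delete : ∀ {n} → ℕ → Vec ℕ (suc n) → Vec ℕ n
  delete {zero}  x (y ∷ ys) = []
  delete {suc n} x (y ∷ ys) = if x ≡ᵇ y then ys else y ∷ delete x ys

  ≡ᵇ-refl : ∀ x → (x ≡ᵇ x) ≡ true
  ≡ᵇ-refl x = Equivalence.to T-≡ (≡⇒≡ᵇ x x refl)

  ≢⇒≡ᵇ-false : ∀ {x y} → x ≢ y → (x ≡ᵇ y) ≡ false
  ≢⇒≡ᵇ-false {x} {y} x≢y with x ≡ᵇ y in eq
  ... | false = refl
  ... | true  = ⊥-elim (x≢y (≡ᵇ⇒≡ x y (subst T (sym eq) _)))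

  indexOf-here : ∀ {n} x (ys : Vec ℕ n) → indexOf x (x ∷ ys) ≡ just zero
  indexOf-here x ys rewrite ≡ᵇ-refl x = refl

  indexOf-there : ∀ {n x y} (ys : Vec ℕ n) → x ≢ y →
                  indexOf x (y ∷ ys) ≡ Maybe.map suc (indexOf x ys)
  indexOf-there ys x≢y rewrite ≢⇒≡ᵇ-false x≢y = refl

  delete-here : ∀ {n} x (ys : Vec ℕ n) → delete x (x ∷ ys) ≡ ys
  delete-here x []      = refl
  delete-here x (_ ∷ _) rewrite ≡ᵇ-refl x = refl

  delete-there : ∀ {n x y} (ys : Vec ℕ (suc n)) → x ≢ y → delete x (y ∷ ys) ≡ y ∷ delete x ys
  delete-there ys x≢y rewrite ≢⇒≡ᵇ-false x≢y = refl

  data IndexOfView (x : ℕ) : ∀ {n} → Vec ℕ n → Fin n → Set where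
    found-here  : ∀ {m} {ys : Vec ℕ m} → IndexOfView x (x ∷ ys) zero
    found-there : ∀ {m y k} {ys : Vec ℕ m} → x ≢ y → indexOf x ys ≡ just k →
                  IndexOfView x (y ∷ ys) (suc k)

  indexOfView : ∀ {n} x (w : Vec ℕ n) k → indexOf x w ≡ just k → IndexOfView x w k
  indexOfView x (y ∷ ys) k eq with x ≟ y
  ... | yes refl rewrite indexOf-here x ys with just-injective eq
  ...   | refl = found-here
  indexOfView x (y ∷ ys) k eq | no x≢y rewrite indexOf-there ys x≢y with indexOf x ys in eq′
  indexOfView x (y ∷ ys) k () | no x≢y | nothing
  indexOfView x (y ∷ ys) k eq | no x≢y | just k′ with just-injective eq
  ...   | refl = found-there x≢y eq′

  ∈⇒indexOf : ∀ {n x} {w : Vec ℕ n} → x ∈ w → Σ (Fin n) λ k → indexOf x w ≡ just k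
  ∈⇒indexOf {x = x} (here {xs = ys} refl) = zero , indexOf-here x ys
  ∈⇒indexOf {x = x} {y ∷ ys} (there x∈ys) with x ≟ y
  ... | yes refl = zero , indexOf-here x ys
  ... | no x≢y with ∈⇒indexOf x∈ys
  ...   | k , eq = suc k , trans (indexOf-there ys x≢y) (cong (Maybe.map suc) eq)

  indexOf⇒∈ : ∀ {n x} {w : Vec ℕ n} {k} → indexOf x w ≡ just k → x ∈ w
  indexOf⇒∈ {x = x} {w} {k} eq with indexOfView x w k eq
  ... | found-here        = here refl
  ... | found-there _ eq′ = there (indexOf⇒∈ eq′)

  removeAt-indexOf : ∀ {n x} (w : Vec ℕ (suc n)) {k} → indexOf x w ≡ just k →
                     removeAt w k ≡ delete x w
  removeAt-indexOf {x = x} w {k} eq with indexOfView x w k eq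
  removeAt-indexOf {zero}  (x ∷ [])     eq | found-here = refl
  removeAt-indexOf {suc n} (x ∷ ys)     eq | found-here = sym (delete-here x ys)
  removeAt-indexOf {zero}  (y ∷ [])     eq | found-there _ ()
  removeAt-indexOf {suc n} (y ∷ z ∷ zs) eq | found-there y≢x eq′ =
    trans (cong (y ∷_) (removeAt-indexOf (z ∷ zs) eq′)) (sym (delete-there (z ∷ zs) y≢x))

  ∈-delete⁺ : ∀ {n z x} (w : Vec ℕ (suc n)) → x ∈ w → z ∈ w → z ≢ x → z ∈ delete x w
  ∈-delete⁺ {zero} (y ∷ []) (here refl) (here refl) z≢x = ⊥-elim (z≢x refl)
  ∈-delete⁺ {zero} (y ∷ []) _ (there ()) z≢x
  ∈-delete⁺ {zero} (y ∷ []) (there ()) _ z≢x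
  ∈-delete⁺ {suc n} {z} {x} (y ∷ ys) x∈w z∈w z≢x with x ≟ y
  ∈-delete⁺ {suc n} (x ∷ ys) _ (here refl) z≢x | yes refl = ⊥-elim (z≢x refl)
  ∈-delete⁺ {suc n} (x ∷ ys) _ (there z∈ys) z≢x | yes refl rewrite delete-here x ys = z∈ys
  ∈-delete⁺ {suc n} (y ∷ ys) (here refl) _ z≢x | no x≢y = ⊥-elim (x≢y refl)
  ∈-delete⁺ {suc n} (y ∷ ys) (there x∈ys) z∈w z≢x | no x≢y rewrite delete-there ys x≢y
    with z∈w
  ... | here z≡y    = here z≡y
  ... | there z∈ys  = there (∈-delete⁺ ys x∈ys z∈ys z≢x)

  ∈-delete⁻ : ∀ {n z x} (w : Vec ℕ (suc n)) → z ∈ delete x w → z ∈ w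
  ∈-delete⁻ {zero} (y ∷ []) ()
  ∈-delete⁻ {suc n} {z} {x} (y ∷ ys) z∈ with x ≟ y
  ... | yes refl rewrite delete-here x ys = there z∈
  ... | no x≢y rewrite delete-there ys x≢y with z∈
  ...   | here z≡y   = here z≡y
  ...   | there z∈′  = there (∈-delete⁻ ys z∈′)

  ∈-delete⇒≢ : ∀ {n z x} {v : Vec ℕ (suc n)} → Distinct v → x ∈ v → z ∈ delete x v → z ≢ x
  ∈-delete⇒≢ {zero} {v = y ∷ []} _ _ ()
  ∈-delete⇒≢ {suc n} {z} {x} {y ∷ ys} (y∉ys ∷ dys) x∈v z∈ with x ≟ y
  ... | yes refl rewrite delete-here x ys = λ z≡x → y∉ys (subst (_∈ ys) z≡x z∈)
  ... | no x≢y rewrite delete-there ys x≢y with x∈v | z∈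
  ...   | here x≡y    | _          = ⊥-elim (x≢y x≡y)
  ...   | there _     | here z≡y   = λ z≡x → x≢y (trans (sym z≡x) z≡y)
  ...   | there x∈ys  | there z∈′  = ∈-delete⇒≢ dys x∈ys z∈′

  Distinct-delete : ∀ {n x} {v : Vec ℕ (suc n)} → Distinct v → Distinct (delete x v)
  Distinct-delete {zero} {v = y ∷ []} _ = []
  Distinct-delete {suc n} {x} {y ∷ ys} (y∉ys ∷ dys) with x ≟ y
  ... | yes refl rewrite delete-here x ys = dys
  ... | no x≢y rewrite delete-there ys x≢y = (λ y∈ → y∉ys (∈-delete⁻ ys y∈)) ∷ Distinct-delete dys

  delete-comm : ∀ {n x y} (w : Vec ℕ (suc (suc n))) → x ≢ y → x ∈ w → y ∈ w →
                delete x (delete y w) ≡ delete y (delete x w)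
  delete-comm {zero} _ _ _ _ = Vec₀-unique _ _
    where
    Vec₀-unique : (u v : Vec ℕ 0) → u ≡ v
    Vec₀-unique [] [] = refl
  delete-comm {suc n} {x} {y} (a ∷ r) x≢y x∈w y∈w with x ≟ a | y ≟ a
  ... | yes refl | yes refl = ⊥-elim (x≢y refl)
  ... | yes refl | no y≢a
    rewrite delete-here x r | delete-there r y≢a | delete-here x (delete y r) = refl
  ... | no x≢a | yes refl
    rewrite delete-here y r | delete-there r x≢a | delete-here y (delete x r) = refl
  ... | no x≢a | no y≢a with x∈w | y∈w
  ...   | here x≡a   | _          = ⊥-elim (x≢a x≡a)
  ...   | there _    | here y≡a   = ⊥-elim (y≢a y≡a)
  ...   | there x∈r  | there y∈r
    rewrite delete-there r y≢a | delete-there r x≢a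
          | delete-there (delete y r) x≢a | delete-there (delete x r) y≢a =
    cong (a ∷_) (delete-comm r x≢y x∈r y∈r)

  indexOf-++ˡ : ∀ {n p x} (a : Vec ℕ n) (c : Vec ℕ p) {j} → indexOf x a ≡ just j →
                indexOf x (a ++ c) ≡ just (j ↑ˡ p)
  indexOf-++ˡ {x = x} a c {j} eq with indexOfView x a j eq
  ... | found-here {ys = ys}         = indexOf-here x (ys ++ c)
  ... | found-there {ys = ys} x≢y eq′ =
    trans (indexOf-there (ys ++ c) x≢y) (cong (Maybe.map suc) (indexOf-++ˡ ys c eq′))

  delete-++ˡ : ∀ {n p x} (a : Vec ℕ (suc n)) (c : Vec ℕ p) → x ∈ a →
               delete x (a ++ c) ≡ delete x a ++ c
  delete-++ˡ {zero} {zero} (y ∷ []) [] _ = refl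
  delete-++ˡ {zero} {suc p} (y ∷ []) c (here refl) = delete-here y c
  delete-++ˡ {zero} {suc p} (y ∷ []) c (there ())
  delete-++ˡ {suc n} {p} {x} (y ∷ ys) c x∈a with x ≟ y
  ... | yes refl rewrite delete-here x ys = delete-here x (ys ++ c)
  ... | no x≢y with x∈a
  ...   | here x≡y = ⊥-elim (x≢y x≡y)
  ...   | there x∈ys rewrite delete-there ys x≢y =
    trans (delete-there (ys ++ c) x≢y) (cong (y ∷_) (delete-++ˡ ys c x∈ys))

  indexOf-∷ʳ : ∀ {n x} (v : Vec ℕ n) → ¬ x ∈ v → indexOf x (v ∷ʳ x) ≡ just (fromℕ n)
  indexOf-∷ʳ {x = x} []       _   = indexOf-here x []
  indexOf-∷ʳ {x = x} (y ∷ ys) x∉v =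
    trans (indexOf-there (ys ∷ʳ x) (λ x≡y → x∉v (here x≡y)))
          (cong (Maybe.map suc) (indexOf-∷ʳ ys (λ x∈ → x∉v (there x∈))))

  delete-∷ʳ : ∀ {n x} (v : Vec ℕ n) → ¬ x ∈ v → delete x (v ∷ʳ x) ≡ v
  delete-∷ʳ []       _   = refl
  delete-∷ʳ (y ∷ ys) x∉v =
    trans (delete-there (ys ∷ʳ _) (λ x≡y → x∉v (here x≡y)))
          (cong (y ∷_) (delete-∷ʳ ys (λ x∈ → x∉v (there x∈))))

  ∈-∷ʳ : ∀ {n z x} (v : Vec ℕ n) → z ∈ x ∷ v → z ∈ v ∷ʳ x
  ∈-∷ʳ []      (here eq)          = here eq
  ∈-∷ʳ (y ∷ v) (here eq)          = there (∈-∷ʳ v (here eq))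
  ∈-∷ʳ (y ∷ v) (there (here eq))  = here eq
  ∈-∷ʳ (y ∷ v) (there (there z∈)) = there (∈-∷ʳ v (there z∈))

  Distinct-++⁺ : ∀ {n p} {u : Vec ℕ n} {v : Vec ℕ p} → Distinct u → Distinct v →
                 (∀ {z} → z ∈ u → z ∈ v → ⊥) → Distinct (u ++ v)
  Distinct-++⁺ [] dv _ = dv
  Distinct-++⁺ {u = y ∷ u} (y∉u ∷ du) dv disj =
    [ y∉u , disj (here refl) ]′ ∘ Any.++⁻ u ∷ Distinct-++⁺ du dv (disj ∘ there)

  Distinct-++⁻ˡ : ∀ {n p} (u : Vec ℕ n) {v : Vec ℕ p} → Distinct (u ++ v) → Distinct u
  Distinct-++⁻ˡ []      _          = []
  Distinct-++⁻ˡ (y ∷ u) (y∉ ∷ d) = (λ y∈u → y∉ (Any.++⁺ˡ y∈u)) ∷ Distinct-++⁻ˡ u d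

  Distinct-++⁻ʳ : ∀ {n p} (u : Vec ℕ n) {v : Vec ℕ p} → Distinct (u ++ v) → Distinct v
  Distinct-++⁻ʳ []      d       = d
  Distinct-++⁻ʳ (y ∷ u) (_ ∷ d) = Distinct-++⁻ʳ u d

  Distinct-++⁻-disjoint : ∀ {n p} (u : Vec ℕ n) {v : Vec ℕ p} → Distinct (u ++ v) →
                          ∀ {z} → z ∈ u → z ∈ v → ⊥
  Distinct-++⁻-disjoint (y ∷ u) (y∉ ∷ _) (here refl) z∈v = y∉ (Any.++⁺ʳ u z∈v)
  Distinct-++⁻-disjoint (y ∷ u) (_ ∷ d)  (there z∈u) z∈v = Distinct-++⁻-disjoint u d z∈u z∈v

  Distinct-++-comm : ∀ {n p} (u : Vec ℕ n) (v : Vec ℕ p) → Distinct (u ++ v) → Distinct (v ++ u)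
  Distinct-++-comm u v d =
    Distinct-++⁺ (Distinct-++⁻ʳ u d) (Distinct-++⁻ˡ u d)
                 (λ z∈v z∈u → Distinct-++⁻-disjoint u d z∈u z∈v)

  indexOf-delete-swap :
    ∀ {n x y} (w : Vec ℕ (suc (suc n))) {j i} → x ≢ y →
    indexOf y w ≡ just j → indexOf x (delete y w) ≡ just i →
    (indexOf x w ≡ just (punchIn j i)) × (indexOf y (delete x w) ≡ just (pinch i j))
  indexOf-delete-swap {n} {x} {y} w {j} {i} x≢y y↦j x↦i with indexOfView y w j y↦j
  ... | found-here {ys = ys} rewrite delete-here y ys =
    trans (indexOf-there ys x≢y) (cong (Maybe.map suc) x↦i) ,
    trans (cong (indexOf y) (delete-there ys x≢y)) (indexOf-here y (delete x ys))
  ... | found-there {y = a} {ys = ys} y≢a y↦j′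
    rewrite delete-there ys y≢a with indexOfView x (a ∷ delete y ys) i x↦i
  ...   | found-here rewrite delete-here x ys = indexOf-here x ys , y↦j′
  indexOf-delete-swap {zero} w x≢y _ _ | found-there _ _ | found-there {k = ()} _ _
  indexOf-delete-swap {suc n} w x≢y _ _ | found-there {ys = ys} y≢a y↦j′ | found-there x≢a x↦i′
    with indexOf-delete-swap ys x≢y y↦j′ x↦i′
  ... | x↦ , y↦ =
    trans (indexOf-there ys x≢a) (cong (Maybe.map suc) x↦) ,
    trans (cong (indexOf _) (delete-there ys x≢a))
          (trans (indexOf-there (delete _ ys) y≢a) (cong (Maybe.map suc) y↦))

  subst-++-[] : ∀ {n} (v : Vec ℕ n) (eq : n ≡ n + 0) → subst (Vec ℕ) eq v ≡ v ++ []
  subst-++-[] v eq = trans (subst-is-cast eq v) (cast-sym (+-identityʳ _) (++-identityʳ-eqFree v))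

  subst-∷ʳ-++ : ∀ {n m} (v : Vec ℕ n) x (u : Vec ℕ m)
                (eq₁ : suc n ≡ n + 1) (eq₂ : (n + 1) + m ≡ n + suc m) →
                subst (Vec ℕ) eq₂ (subst (Vec ℕ) eq₁ (v ∷ʳ x) ++ u) ≡ v ++ (x ∷ u)
  subst-∷ʳ-++ v x u eq₁ eq₂ = begin
    subst (Vec ℕ) eq₂ (subst (Vec ℕ) eq₁ (v ∷ʳ x) ++ u) ≡⟨ subst-is-cast eq₂ _ ⟩
    cast eq₂ (subst (Vec ℕ) eq₁ (v ∷ʳ x) ++ u)
      ≡⟨ cong (λ w → cast eq₂ (w ++ u)) (trans (subst-is-cast eq₁ _) (unfold-∷ʳ-eqFree x v)) ⟩
    cast eq₂ ((v ++ [ x ]) ++ u)                         ≡⟨ ++-assoc-eqFree v [ x ] u ⟩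
    v ++ (x ∷ u)                                         ∎
    where open ≡-Reasoning

  ∈-subst : ∀ {k k′ z} (eq : k ≡ k′) {v : Vec ℕ k} → z ∈ v → z ∈ subst (Vec ℕ) eq v
  ∈-subst refl z∈ = z∈

open NameLists

module Enumerations where

  memN-∪ₙ : ∀ x s t → memN x (s ∪ₙ t) ≡ memN x s ∨ memN x t
  memN-∪ₙ zero    one      one      = refl
  memN-∪ₙ (suc x) one      one      = refl
  memN-∪ₙ zero    one      (b ∷ᵇ t) = refl
  memN-∪ₙ (suc x) one      (b ∷ᵇ t) = refl
  memN-∪ₙ zero    (true ∷ᵇ s)  one  = refl
  memN-∪ₙ zero    (false ∷ᵇ s) one  = refl
  memN-∪ₙ (suc x) (b ∷ᵇ s) one      = sym (∨-identityʳ (memN x s))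
  memN-∪ₙ zero    (b ∷ᵇ s) (c ∷ᵇ t) = refl
  memN-∪ₙ (suc x) (b ∷ᵇ s) (c ∷ᵇ t) = memN-∪ₙ x s t

  ∈ₛ-∪⁻ : ∀ x A B → x ∈ₛ (A ∪ B) → x ∈ₛ A ⊎ x ∈ₛ B
  ∈ₛ-∪⁻ x ∅      B      x∈ = inj₂ x∈
  ∈ₛ-∪⁻ x (ne s) ∅      x∈ = inj₁ x∈
  ∈ₛ-∪⁻ x (ne s) (ne t) x∈ = Equivalence.to T-∨ (subst T (memN-∪ₙ x s t) x∈)

  ∈ₛ-∪⁺ˡ : ∀ x A B → x ∈ₛ A → x ∈ₛ (A ∪ B)
  ∈ₛ-∪⁺ˡ x (ne s) ∅      x∈ = x∈
  ∈ₛ-∪⁺ˡ x (ne s) (ne t) x∈ = subst T (sym (memN-∪ₙ x s t)) (Equivalence.from T-∨ (inj₁ x∈))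

  ∈ₛ-∪⁺ʳ : ∀ x A B → x ∈ₛ B → x ∈ₛ (A ∪ B)
  ∈ₛ-∪⁺ʳ x ∅      B      x∈ = x∈
  ∈ₛ-∪⁺ʳ x (ne s) (ne t) x∈ = subst T (sym (memN-∪ₙ x s t)) (Equivalence.from T-∨ (inj₂ x∈))

  memN-singleN⇒≡ : ∀ x y → T (memN x (singleN y)) → x ≡ y
  memN-singleN⇒≡ zero    zero    _ = refl
  memN-singleN⇒≡ (suc x) (suc y) m = cong suc (memN-singleN⇒≡ x y m)

  memN-singleN : ∀ y → T (memN y (singleN y))
  memN-singleN zero    = _
  memN-singleN (suc y) = memN-singleN y

  ∈⇒∈ₛ-set : ∀ {n x} {a : Vec ℕ n} → x ∈ a → x ∈ₛ set a
  ∈⇒∈ₛ-set {x = x} {y ∷ a} (here refl) = ∈ₛ-∪⁺ˡ x (ne (singleN x)) (set a) (memN-singleN x)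
  ∈⇒∈ₛ-set {x = x} {y ∷ a} (there x∈) = ∈ₛ-∪⁺ʳ x (ne (singleN y)) (set a) (∈⇒∈ₛ-set x∈)

  ∈ₛ-set⇒∈ : ∀ {n x} (a : Vec ℕ n) → x ∈ₛ set a → x ∈ a
  ∈ₛ-set⇒∈ {x = x} (y ∷ a) x∈ with ∈ₛ-∪⁻ x (ne (singleN y)) (set a) x∈
  ... | inj₁ x∈y = here (memN-singleN⇒≡ x y x∈y)
  ... | inj₂ x∈a = there (∈ₛ-set⇒∈ a x∈a)

  _∈ₛ?_ : ∀ x A → Dec (x ∈ₛ A)
  x ∈ₛ? ∅    = no (λ ())
  x ∈ₛ? ne t = T? (memN x t)

  singleN-∪ₙ-absorb : ∀ y t → T (memN y t) → singleN y ∪ₙ t ≡ t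
  singleN-∪ₙ-absorb zero    one       _ = refl
  singleN-∪ₙ-absorb zero    (true ∷ᵇ t) _ = refl
  singleN-∪ₙ-absorb (suc y) (b ∷ᵇ t)  m = cong (b ∷ᵇ_) (singleN-∪ₙ-absorb y t m)

  cardN-singleN : ∀ y → cardN (singleN y) ≡ 1
  cardN-singleN zero    = refl
  cardN-singleN (suc y) = cardN-singleN y

  card-insert-∈ : ∀ y A → y ∈ₛ A → card (ne (singleN y) ∪ A) ≡ card A
  card-insert-∈ y (ne t) y∈ = cong cardN (singleN-∪ₙ-absorb y t y∈)

  card-insert-∉ : ∀ y A → ¬ y ∈ₛ A → card (ne (singleN y) ∪ A) ≡ suc (card A)
  card-insert-∉ y A y∉ =
    trans (card-∪ (ne (singleN y)) A
                  (λ x x∈y x∈A → y∉ (subst (_∈ₛ A) (memN-singleN⇒≡ x y x∈y) x∈A)))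
          (cong (_+ card A) (cardN-singleN y))

  card-set≤length : ∀ {n} (a : Vec ℕ n) → card (set a) ≤ n
  card-set≤length []      = z≤n
  card-set≤length (y ∷ a) with y ∈ₛ? set a
  ... | yes y∈ rewrite card-insert-∈ y (set a) y∈ = ≤-trans (card-set≤length a) (n≤1+n _)
  ... | no y∉  rewrite card-insert-∉ y (set a) y∉ = s≤s (card-set≤length a)

  length≡card-set⇒Distinct : ∀ {n} (a : Vec ℕ n) → n ≡ card (set a) → Distinct a
  length≡card-set⇒Distinct []      _  = []
  length≡card-set⇒Distinct (y ∷ a) eq with y ∈ₛ? set a
  ... | yes y∈ rewrite card-insert-∈ y (set a) y∈ =
    ⊥-elim (1+n≰n (≤-trans (≤-reflexive eq) (card-set≤length a)))
  ... | no y∉  rewrite card-insert-∉ y (set a) y∉ =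
    (λ y∈ → y∉ (∈⇒∈ₛ-set y∈)) ∷ length≡card-set⇒Distinct a (suc-injective eq)

  Enum⇒Distinct : ∀ {n A} (a : Vec ℕ n) → Enum a A → Distinct a
  Enum⇒Distinct a (refl , eq) = length≡card-set⇒Distinct a eq

  Enum⇒⊆ : ∀ {n m A} (a : Vec ℕ n) (b : Vec ℕ m) → Enum a A → Enum b A → a ⊆ b
  Enum⇒⊆ a b (refl , _) (eq , _) z∈ = ∈ₛ-set⇒∈ b (subst (_ ∈ₛ_) (sym eq) (∈⇒∈ₛ-set z∈))

  Enum-length : ∀ {n m A} (a : Vec ℕ n) (b : Vec ℕ m) → Enum a A → Enum b A → n ≡ m
  Enum-length _ _ (_ , eq) (_ , eq′) = trans eq (sym eq′)

open Enumerations

module PROPProperties {c ℓ : Level} (S : PROP c ℓ) where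
  open PROP S public
  open Symmetries S public

  module ≈ {m n} = IsEquivalence (≈-equiv {m} {n})

  homSetoid : ℕ → ℕ → Setoid c ℓ
  homSetoid m n = record { Carrier = Hom m n ; _≈_ = _≈_ ; isEquivalence = ≈-equiv }

  module ≈-Reasoning {m n} = SetoidReasoning (homSetoid m n)
  open ≈-Reasoning

  ≡⇒≈ : ∀ {m n} {f g : Hom m n} → f ≡ g → f ≈ g
  ≡⇒≈ refl = ≈.refl

  ⨾-congˡ : ∀ {l m n} {f : Hom l m} {g g′ : Hom m n} → g ≈ g′ → f ⨾ g ≈ f ⨾ g′
  ⨾-congˡ = ⨾-cong ≈.refl

  ⨾-congʳ : ∀ {l m n} {f f′ : Hom l m} {g : Hom m n} → f ≈ f′ → f ⨾ g ≈ f′ ⨾ g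
  ⨾-congʳ p = ⨾-cong p ≈.refl

  ⊕-congˡ : ∀ {m n p q} {f : Hom m n} {g g′ : Hom p q} → g ≈ g′ → f ⊕ g ≈ f ⊕ g′
  ⊕-congˡ = ⊕-cong ≈.refl

  ⊕-congʳ : ∀ {m n p q} {f f′ : Hom m n} {g : Hom p q} → f ≈ f′ → f ⊕ g ≈ f′ ⊕ g
  ⊕-congʳ p = ⊕-cong p ≈.refl

  assoc˘ : ∀ {k l m n} (f : Hom k l) (g : Hom l m) (h : Hom m n) → f ⨾ (g ⨾ h) ≈ (f ⨾ g) ⨾ h
  assoc˘ f g h = ≈.sym (assoc f g h)

  id⊕-⨾ : ∀ k {l m n} (f : Hom l m) (g : Hom m n) → id k ⊕ (f ⨾ g) ≈ (id k ⊕ f) ⨾ (id k ⊕ g)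
  id⊕-⨾ k f g = ≈.trans (⊕-congʳ (≈.sym (idˡ (id k)))) (⊕-⨾ (id k) (id k) f g)

  ⨾-⊕id : ∀ k {l m n} (f : Hom l m) (g : Hom m n) → (f ⨾ g) ⊕ id k ≈ (f ⊕ id k) ⨾ (g ⊕ id k)
  ⨾-⊕id k f g = ≈.trans (⊕-congˡ (≈.sym (idˡ (id k)))) (⊕-⨾ f g (id k) (id k))

  swap₀₁ : ∀ n → Hom (2 + n) (2 + n)
  swap₀₁ n = σ 1 1 ⊕ id n

  swap₁₂ : ∀ n → Hom (3 + n) (3 + n)
  swap₁₂ n = id 1 ⊕ swap₀₁ n

  swap₀₁-involutive : ∀ n → swap₀₁ n ⨾ swap₀₁ n ≈ id (2 + n)
  swap₀₁-involutive n = begin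
    (σ 1 1 ⊕ id n) ⨾ (σ 1 1 ⊕ id n) ≈⟨ ⊕-⨾ (σ 1 1) (σ 1 1) (id n) (id n) ⟨
    (σ 1 1 ⨾ σ 1 1) ⊕ (id n ⨾ id n) ≈⟨ ⊕-cong (σ-inv 1 1) (idˡ (id n)) ⟩
    id 2 ⊕ id n                     ≈⟨ ⊕-id 2 n ⟩
    id (2 + n)                      ∎

  swap₀₁-natural : ∀ {m m′} (f : Hom m m′) →
                   swap₀₁ m ⨾ (id 1 ⊕ (id 1 ⊕ f)) ≈ (id 1 ⊕ (id 1 ⊕ f)) ⨾ swap₀₁ m′
  swap₀₁-natural {m} {m′} f = begin
    (σ 1 1 ⊕ id m) ⨾ (id 1 ⊕ (id 1 ⊕ f)) ≈⟨ ⨾-congˡ id₂⊕ ⟩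
    (σ 1 1 ⊕ id m) ⨾ (id 2 ⊕ f)           ≈⟨ ⊕-⨾ _ _ _ _ ⟨
    (σ 1 1 ⨾ id 2) ⊕ (id m ⨾ f)           ≈⟨ ⊕-cong (idʳ _) (idˡ f) ⟩
    σ 1 1 ⊕ f                             ≈⟨ ⊕-cong (idˡ _) (idʳ f) ⟨
    (id 2 ⨾ σ 1 1) ⊕ (f ⨾ id m′)          ≈⟨ ⊕-⨾ _ _ _ _ ⟩
    (id 2 ⊕ f) ⨾ (σ 1 1 ⊕ id m′)          ≈⟨ ⨾-congʳ id₂⊕ ⟨
    (id 1 ⊕ (id 1 ⊕ f)) ⨾ (σ 1 1 ⊕ id m′) ∎
    where
    id₂⊕ : ∀ {k k′} {h : Hom k k′} → id 1 ⊕ (id 1 ⊕ h) ≈ id 2 ⊕ h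
    id₂⊕ {h = h} = ≈.trans (≈.sym (⊕-assoc (id 1) (id 1) h)) (⊕-congʳ (⊕-id 1 1))

  braid₃ : ((σ 1 1 ⊕ id 1) ⨾ (id 1 ⊕ σ 1 1)) ⨾ (σ 1 1 ⊕ id 1) ≈
           ((id 1 ⊕ σ 1 1) ⨾ (σ 1 1 ⊕ id 1)) ⨾ (id 1 ⊕ σ 1 1)
  braid₃ = begin
    ((σ 1 1 ⊕ id 1) ⨾ (id 1 ⊕ σ 1 1)) ⨾ (σ 1 1 ⊕ id 1) ≈⟨ assoc _ _ _ ⟩
    (σ 1 1 ⊕ id 1) ⨾ ((id 1 ⊕ σ 1 1) ⨾ (σ 1 1 ⊕ id 1)) ≈⟨ ⨾-congˡ (σ-hex 1 1 1) ⟨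
    (σ 1 1 ⊕ id 1) ⨾ σ 2 1                             ≈⟨ σ-nat (σ 1 1) (id 1) ⟩
    σ 2 1 ⨾ (id 1 ⊕ σ 1 1)                             ≈⟨ ⨾-congʳ (σ-hex 1 1 1) ⟩
    ((id 1 ⊕ σ 1 1) ⨾ (σ 1 1 ⊕ id 1)) ⨾ (id 1 ⊕ σ 1 1) ∎

  swap-braid : ∀ n → (swap₀₁ (suc n) ⨾ swap₁₂ n) ⨾ swap₀₁ (suc n) ≈
                     (swap₁₂ n ⨾ swap₀₁ (suc n)) ⨾ swap₁₂ n
  swap-braid n = begin
    (swap₀₁ (suc n) ⨾ swap₁₂ n) ⨾ swap₀₁ (suc n) ≈⟨ ⨾-cong (⨾-cong swap₀₁-lift swap₁₂-lift) swap₀₁-lift ⟩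
    _                                            ≈⟨ ⨾-⊕id₃ ⟩
    _                                            ≈⟨ ⊕-congʳ braid₃ ⟩
    _                                            ≈⟨ ⨾-⊕id₃ ⟨
    _                                            ≈⟨ ⨾-cong (⨾-cong swap₁₂-lift swap₀₁-lift) swap₁₂-lift ⟨
    (swap₁₂ n ⨾ swap₀₁ (suc n)) ⨾ swap₁₂ n       ∎
    where
    swap₀₁-lift : swap₀₁ (suc n) ≈ (σ 1 1 ⊕ id 1) ⊕ id n
    swap₀₁-lift = ≈.trans (⊕-congˡ (≈.sym (⊕-id 1 n))) (≈.sym (⊕-assoc (σ 1 1) (id 1) (id n)))
    swap₁₂-lift : swap₁₂ n ≈ (id 1 ⊕ σ 1 1) ⊕ id n
    swap₁₂-lift = ≈.sym (⊕-assoc (id 1) (σ 1 1) (id n))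
    ⨾-⊕id₃ : ∀ {f g h : Hom 3 3} → ((f ⊕ id n) ⨾ (g ⊕ id n)) ⨾ (h ⊕ id n) ≈ ((f ⨾ g) ⨾ h) ⊕ id n
    ⨾-⊕id₃ {f} {g} {h} = ≈.sym (≈.trans (⨾-⊕id n (f ⨾ g) h) (⨾-congʳ (⨾-⊕id n f g)))

  -- Inserting the first two wires at positions j and i, in either order, gives the same
  -- permutation; the inductive step is the braid relation.
  swap-ins-ins : ∀ {n} (j : Fin (2 + n)) (i : Fin (1 + n)) →
                 swap₀₁ n ⨾ ((id 1 ⊕ ins i) ⨾ ins j) ≈ (id 1 ⊕ ins (pinch i j)) ⨾ ins (punchIn j i)
  swap-ins-ins {n} zero i = begin
    swap₀₁ n ⨾ ((id 1 ⊕ ins i) ⨾ id _)           ≈⟨ ⨾-congˡ (idʳ _) ⟩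
    swap₀₁ n ⨾ (id 1 ⊕ ins i)                    ≈⟨ idˡ _ ⟨
    id _ ⨾ (swap₀₁ n ⨾ (id 1 ⊕ ins i))           ≈⟨ ⨾-congʳ (⊕-id 1 (suc n)) ⟨
    (id 1 ⊕ id (suc n)) ⨾ (swap₀₁ n ⨾ (id 1 ⊕ ins i)) ∎
  swap-ins-ins {n} (suc j) zero = begin
    swap₀₁ n ⨾ ((id 1 ⊕ id (suc n)) ⨾ (swap₀₁ n ⨾ (id 1 ⊕ ins j))) ≈⟨ ⨾-congˡ (⨾-congʳ (⊕-id 1 (suc n))) ⟩
    swap₀₁ n ⨾ (id _ ⨾ (swap₀₁ n ⨾ (id 1 ⊕ ins j)))                ≈⟨ ⨾-congˡ (idˡ _) ⟩
    swap₀₁ n ⨾ (swap₀₁ n ⨾ (id 1 ⊕ ins j))                         ≈⟨ assoc˘ _ _ _ ⟩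
    (swap₀₁ n ⨾ swap₀₁ n) ⨾ (id 1 ⊕ ins j)                         ≈⟨ ⨾-congʳ (swap₀₁-involutive n) ⟩
    id _ ⨾ (id 1 ⊕ ins j)                                          ≈⟨ idˡ _ ⟩
    id 1 ⊕ ins j                                                   ≈⟨ idʳ _ ⟨
    (id 1 ⊕ ins j) ⨾ id _                                          ∎
  swap-ins-ins {suc n} (suc j) (suc i) = begin
    S₀₁ ⨾ ((id 1 ⊕ (swap₀₁ n ⨾ (id 1 ⊕ ins i))) ⨾ (S₀₁ ⨾ v)) ≈⟨ ⨾-congˡ (⨾-congʳ (id⊕-⨾ 1 _ _)) ⟩
    S₀₁ ⨾ ((S₁₂ ⨾ u) ⨾ (S₀₁ ⨾ v))    ≈⟨ ⨾-congˡ (assoc _ _ _) ⟩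
    S₀₁ ⨾ (S₁₂ ⨾ (u ⨾ (S₀₁ ⨾ v)))    ≈⟨ ⨾-congˡ (⨾-congˡ (assoc˘ _ _ _)) ⟩
    S₀₁ ⨾ (S₁₂ ⨾ ((u ⨾ S₀₁) ⨾ v))    ≈⟨ ⨾-congˡ (⨾-congˡ (⨾-congʳ (swap₀₁-natural (ins i)))) ⟨
    S₀₁ ⨾ (S₁₂ ⨾ ((S₀₁ ⨾ u) ⨾ v))    ≈⟨ ⨾-congˡ (⨾-congˡ (assoc _ _ _)) ⟩
    S₀₁ ⨾ (S₁₂ ⨾ (S₀₁ ⨾ (u ⨾ v)))    ≈⟨ assoc˘ _ _ _ ⟩
    (S₀₁ ⨾ S₁₂) ⨾ (S₀₁ ⨾ (u ⨾ v))    ≈⟨ assoc˘ _ _ _ ⟩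
    ((S₀₁ ⨾ S₁₂) ⨾ S₀₁) ⨾ (u ⨾ v)    ≈⟨ ⨾-congʳ (swap-braid n) ⟩
    ((S₁₂ ⨾ S₀₁) ⨾ S₁₂) ⨾ (u ⨾ v)    ≈⟨ assoc _ _ _ ⟩
    (S₁₂ ⨾ S₀₁) ⨾ (S₁₂ ⨾ (u ⨾ v))    ≈⟨ assoc _ _ _ ⟩
    S₁₂ ⨾ (S₀₁ ⨾ (S₁₂ ⨾ (u ⨾ v)))    ≈⟨ ⨾-congˡ (⨾-congˡ (≈.sym (≈.trans (id⊕-⨾ 1 _ _) (⨾-congˡ (id⊕-⨾ 1 _ _))))) ⟩
    S₁₂ ⨾ (S₀₁ ⨾ (id 1 ⊕ (swap₀₁ n ⨾ ((id 1 ⊕ ins i) ⨾ ins j))))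
                                     ≈⟨ ⨾-congˡ (⨾-congˡ (⊕-congˡ (swap-ins-ins j i))) ⟩
    S₁₂ ⨾ (S₀₁ ⨾ (id 1 ⊕ ((id 1 ⊕ ins (pinch i j)) ⨾ ins (punchIn j i))))
                                     ≈⟨ ⨾-congˡ (⨾-congˡ (id⊕-⨾ 1 _ _)) ⟩
    S₁₂ ⨾ (S₀₁ ⨾ (u′ ⨾ v′))          ≈⟨ ⨾-congˡ (assoc˘ _ _ _) ⟩
    S₁₂ ⨾ ((S₀₁ ⨾ u′) ⨾ v′)          ≈⟨ ⨾-congˡ (⨾-congʳ (swap₀₁-natural (ins (pinch i j)))) ⟩
    S₁₂ ⨾ ((u′ ⨾ S₀₁) ⨾ v′)          ≈⟨ ⨾-congˡ (assoc _ _ _) ⟩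
    S₁₂ ⨾ (u′ ⨾ (S₀₁ ⨾ v′))          ≈⟨ assoc˘ _ _ _ ⟩
    (S₁₂ ⨾ u′) ⨾ (S₀₁ ⨾ v′)          ≈⟨ ⨾-congʳ (id⊕-⨾ 1 _ _) ⟨
    (id 1 ⊕ (swap₀₁ n ⨾ (id 1 ⊕ ins (pinch i j)))) ⨾ (S₀₁ ⨾ (id 1 ⊕ ins (punchIn j i))) ∎
    where
    S₀₁ = swap₀₁ (suc n)
    S₁₂ = swap₁₂ n
    u   = id 1 ⊕ (id 1 ⊕ ins i)
    v   = id 1 ⊕ ins j
    u′  = id 1 ⊕ (id 1 ⊕ ins (pinch i j))
    v′  = id 1 ⊕ ins (punchIn j i)

  swap-ins-ins-⊕ : ∀ {n} (R : Hom n n) (j : Fin (2 + n)) (i : Fin (1 + n)) →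
                   swap₀₁ n ⨾ ((id 1 ⊕ ((id 1 ⊕ R) ⨾ ins i)) ⨾ ins j) ≈
                   (id 1 ⊕ ((id 1 ⊕ R) ⨾ ins (pinch i j))) ⨾ ins (punchIn j i)
  swap-ins-ins-⊕ {n} R j i = begin
    swap₀₁ n ⨾ ((id 1 ⊕ ((id 1 ⊕ R) ⨾ ins i)) ⨾ ins j)  ≈⟨ ⨾-congˡ (⨾-congʳ (id⊕-⨾ 1 _ _)) ⟩
    swap₀₁ n ⨾ ((u ⨾ (id 1 ⊕ ins i)) ⨾ ins j)           ≈⟨ ⨾-congˡ (assoc _ _ _) ⟩
    swap₀₁ n ⨾ (u ⨾ ((id 1 ⊕ ins i) ⨾ ins j))           ≈⟨ assoc˘ _ _ _ ⟩
    (swap₀₁ n ⨾ u) ⨾ ((id 1 ⊕ ins i) ⨾ ins j)           ≈⟨ ⨾-congʳ (swap₀₁-natural R) ⟩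
    (u ⨾ swap₀₁ n) ⨾ ((id 1 ⊕ ins i) ⨾ ins j)           ≈⟨ assoc _ _ _ ⟩
    u ⨾ (swap₀₁ n ⨾ ((id 1 ⊕ ins i) ⨾ ins j))           ≈⟨ ⨾-congˡ (swap-ins-ins j i) ⟩
    u ⨾ ((id 1 ⊕ ins (pinch i j)) ⨾ ins (punchIn j i))  ≈⟨ assoc˘ _ _ _ ⟩
    (u ⨾ (id 1 ⊕ ins (pinch i j))) ⨾ ins (punchIn j i)  ≈⟨ ⨾-congʳ (id⊕-⨾ 1 _ _) ⟨
    (id 1 ⊕ ((id 1 ⊕ R) ⨾ ins (pinch i j))) ⨾ ins (punchIn j i) ∎
    where u = id 1 ⊕ (id 1 ⊕ R)

module PermutationLemmas {c ℓ : Level} (S : PROP c ℓ) where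
  open PROPProperties S
  open ≈-Reasoning

  findIdx≡indexOf : ∀ {n} x (w : Vec ℕ n) → findIdx x w ≡ indexOf x w
  findIdx≡indexOf x []      = refl
  findIdx≡indexOf x (y ∷ w) rewrite findIdx≡indexOf x w = refl

  ⟨∷∣⟩-removeAt : ∀ {n} x (xs : Vec ℕ n) (w : Vec ℕ (suc n)) {k} → indexOf x w ≡ just k →
                  ⟨ x ∷ xs ∣ w ⟩ ≡ (id 1 ⊕ ⟨ xs ∣ removeAt w k ⟩) ⨾ ins k
  ⟨∷∣⟩-removeAt x xs w eq rewrite trans (findIdx≡indexOf x w) eq = refl

  ⟨∷∣⟩-delete : ∀ {n} x (xs : Vec ℕ n) (w : Vec ℕ (suc n)) {k} → indexOf x w ≡ just k →
                ⟨ x ∷ xs ∣ w ⟩ ≡ (id 1 ⊕ ⟨ xs ∣ delete x w ⟩) ⨾ ins k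
  ⟨∷∣⟩-delete x xs w {k} eq =
    trans (⟨∷∣⟩-removeAt x xs w eq)
          (cong (λ w′ → (id 1 ⊕ ⟨ xs ∣ w′ ⟩) ⨾ ins k) (removeAt-indexOf w eq))

  ⟨∣⟩-refl : ∀ {n} (v : Vec ℕ n) → ⟨ v ∣ v ⟩ ≈ id n
  ⟨∣⟩-refl []            = ≈.refl
  ⟨∣⟩-refl {suc n} (x ∷ v) = begin
    ⟨ x ∷ v ∣ x ∷ v ⟩        ≡⟨ ⟨∷∣⟩-removeAt x v (x ∷ v) (indexOf-here x v) ⟩
    (id 1 ⊕ ⟨ v ∣ v ⟩) ⨾ id _ ≈⟨ idʳ _ ⟩
    id 1 ⊕ ⟨ v ∣ v ⟩         ≈⟨ ⊕-congˡ (⟨∣⟩-refl v) ⟩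
    id 1 ⊕ id n              ≈⟨ ⊕-id 1 n ⟩
    id (suc n)               ∎

  ins-⨾-⟨∣⟩ : ∀ {n} {v w : Vec ℕ (suc n)} {x k} → Distinct v → v ⊆ w → indexOf x v ≡ just k →
              ins k ⨾ ⟨ v ∣ w ⟩ ≈ ⟨ x ∷ delete x v ∣ w ⟩
  ins-⨾-⟨∣⟩ {n} {v} {w} {x} {k} _ _ x↦k with indexOfView x v k x↦k
  ... | found-here {ys = ys} = begin
    id _ ⨾ ⟨ x ∷ ys ∣ w ⟩       ≈⟨ idˡ _ ⟩
    ⟨ x ∷ ys ∣ w ⟩              ≡⟨ cong (λ ys′ → ⟨ x ∷ ys′ ∣ w ⟩) (delete-here x ys) ⟨
    ⟨ x ∷ delete x (x ∷ ys) ∣ w ⟩ ∎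
  ins-⨾-⟨∣⟩ {zero} _ _ _ | found-there {k = ()} _ _
  ins-⨾-⟨∣⟩ {suc n} {v} {w} {x} (y∉ys ∷ dys) v⊆w _ | found-there {y = y} {k = k} {ys = ys} x≢y x↦k = begin
    ins (suc k) ⨾ ⟨ y ∷ ys ∣ w ⟩                       ≡⟨ cong (ins (suc k) ⨾_) (⟨∷∣⟩-delete y ys w y↦j) ⟩
    (swap₀₁ n ⨾ (id 1 ⊕ ins k)) ⨾ ((id 1 ⊕ A) ⨾ ins j)  ≈⟨ assoc _ _ _ ⟩
    swap₀₁ n ⨾ ((id 1 ⊕ ins k) ⨾ ((id 1 ⊕ A) ⨾ ins j))  ≈⟨ ⨾-congˡ (assoc˘ _ _ _) ⟩
    swap₀₁ n ⨾ (((id 1 ⊕ ins k) ⨾ (id 1 ⊕ A)) ⨾ ins j)  ≈⟨ ⨾-congˡ (⨾-congʳ (id⊕-⨾ 1 _ _)) ⟨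
    swap₀₁ n ⨾ ((id 1 ⊕ (ins k ⨾ A)) ⨾ ins j)           ≈⟨ ⨾-congˡ (⨾-congʳ (⊕-congˡ (ins-⨾-⟨∣⟩ dys ys⊆w∖y x↦k))) ⟩
    swap₀₁ n ⨾ ((id 1 ⊕ ⟨ x ∷ delete x ys ∣ delete y w ⟩) ⨾ ins j)
      ≡⟨ cong (λ h → swap₀₁ n ⨾ ((id 1 ⊕ h) ⨾ ins j)) (⟨∷∣⟩-delete x (delete x ys) (delete y w) x↦i) ⟩
    swap₀₁ n ⨾ ((id 1 ⊕ ((id 1 ⊕ R) ⨾ ins i)) ⨾ ins j)  ≈⟨ swap-ins-ins-⊕ R j i ⟩
    (id 1 ⊕ ((id 1 ⊕ R) ⨾ ins (pinch i j))) ⨾ ins (punchIn j i)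
      ≡⟨ cong (λ w′ → (id 1 ⊕ ((id 1 ⊕ ⟨ delete x ys ∣ w′ ⟩) ⨾ ins (pinch i j))) ⨾ ins (punchIn j i))
              (delete-comm w x≢y x∈w y∈w) ⟩
    (id 1 ⊕ ((id 1 ⊕ ⟨ delete x ys ∣ delete y (delete x w) ⟩) ⨾ ins (pinch i j))) ⨾ ins (punchIn j i)
      ≡⟨ cong (λ h → (id 1 ⊕ h) ⨾ ins (punchIn j i)) (⟨∷∣⟩-delete y (delete x ys) (delete x w) y↦) ⟨
    (id 1 ⊕ ⟨ y ∷ delete x ys ∣ delete x w ⟩) ⨾ ins (punchIn j i)
      ≡⟨ ⟨∷∣⟩-delete x (y ∷ delete x ys) w x↦ ⟨
    ⟨ x ∷ y ∷ delete x ys ∣ w ⟩                        ≡⟨ cong (λ ys′ → ⟨ x ∷ ys′ ∣ w ⟩) (delete-there ys x≢y) ⟨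
    ⟨ x ∷ delete x (y ∷ ys) ∣ w ⟩                      ∎
    where
    y∈w = v⊆w (here refl)
    x∈w = v⊆w (there (indexOf⇒∈ x↦k))
    j = proj₁ (∈⇒indexOf y∈w)
    y↦j = proj₂ (∈⇒indexOf y∈w)
    ys⊆w∖y : ys ⊆ delete y w
    ys⊆w∖y z∈ = ∈-delete⁺ w y∈w (v⊆w (there z∈)) (λ z≡y → y∉ys (subst (_∈ ys) z≡y z∈))
    i = proj₁ (∈⇒indexOf (∈-delete⁺ w y∈w x∈w x≢y))
    x↦i = proj₂ (∈⇒indexOf (∈-delete⁺ w y∈w x∈w x≢y))
    x↦ = proj₁ (indexOf-delete-swap w x≢y y↦j x↦i)
    y↦ = proj₂ (indexOf-delete-swap w x≢y y↦j x↦i)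
    A = ⟨ ys ∣ delete y w ⟩
    R = ⟨ delete x ys ∣ delete x (delete y w) ⟩

  ⟨∣⟩-trans : ∀ {n} {u v w : Vec ℕ n} → Distinct u → Distinct v → u ⊆ v → u ⊆ w → v ⊆ w →
              ⟨ u ∣ v ⟩ ⨾ ⟨ v ∣ w ⟩ ≈ ⟨ u ∣ w ⟩
  ⟨∣⟩-trans {u = []} {[]} {[]} _ _ _ _ _ = idˡ _
  ⟨∣⟩-trans {suc n} {x ∷ xs} {v} {w} (x∉xs ∷ dxs) dv u⊆v u⊆w v⊆w = begin
    ⟨ x ∷ xs ∣ v ⟩ ⨾ ⟨ v ∣ w ⟩             ≡⟨ cong (_⨾ ⟨ v ∣ w ⟩) (⟨∷∣⟩-delete x xs v x↦k) ⟩
    ((id 1 ⊕ A) ⨾ ins k) ⨾ ⟨ v ∣ w ⟩        ≈⟨ assoc _ _ _ ⟩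
    (id 1 ⊕ A) ⨾ (ins k ⨾ ⟨ v ∣ w ⟩)        ≈⟨ ⨾-congˡ (ins-⨾-⟨∣⟩ dv v⊆w x↦k) ⟩
    (id 1 ⊕ A) ⨾ ⟨ x ∷ delete x v ∣ w ⟩     ≡⟨ cong ((id 1 ⊕ A) ⨾_) (⟨∷∣⟩-delete x (delete x v) w x↦j) ⟩
    (id 1 ⊕ A) ⨾ ((id 1 ⊕ B) ⨾ ins j)       ≈⟨ assoc˘ _ _ _ ⟩
    ((id 1 ⊕ A) ⨾ (id 1 ⊕ B)) ⨾ ins j       ≈⟨ ⨾-congʳ (id⊕-⨾ 1 A B) ⟨
    (id 1 ⊕ (A ⨾ B)) ⨾ ins j
      ≈⟨ ⨾-congʳ (⊕-congˡ (⟨∣⟩-trans dxs (Distinct-delete dv) xs⊆v∖x xs⊆w∖x v∖x⊆w∖x)) ⟩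
    (id 1 ⊕ ⟨ xs ∣ delete x w ⟩) ⨾ ins j    ≡⟨ ⟨∷∣⟩-delete x xs w x↦j ⟨
    ⟨ x ∷ xs ∣ w ⟩                          ∎
    where
    x∈v = u⊆v (here refl)
    x∈w = u⊆w (here refl)
    k = proj₁ (∈⇒indexOf x∈v)
    x↦k = proj₂ (∈⇒indexOf x∈v)
    j = proj₁ (∈⇒indexOf x∈w)
    x↦j = proj₂ (∈⇒indexOf x∈w)
    A = ⟨ xs ∣ delete x v ⟩
    B = ⟨ delete x v ∣ delete x w ⟩
    ≢x : ∀ {z} → z ∈ xs → z ≢ x
    ≢x z∈ z≡x = x∉xs (subst (_∈ xs) z≡x z∈)
    xs⊆v∖x : xs ⊆ delete x v
    xs⊆v∖x z∈ = ∈-delete⁺ v x∈v (u⊆v (there z∈)) (≢x z∈)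
    xs⊆w∖x : xs ⊆ delete x w
    xs⊆w∖x z∈ = ∈-delete⁺ w x∈w (u⊆w (there z∈)) (≢x z∈)
    v∖x⊆w∖x : delete x v ⊆ delete x w
    v∖x⊆w∖x z∈ = ∈-delete⁺ w x∈w (v⊆w (∈-delete⁻ v z∈)) (∈-delete⇒≢ dv x∈v z∈)

  ins-⊕-id : ∀ {n} p (j : Fin (suc n)) → ins j ⊕ id p ≈ ins (j ↑ˡ p)
  ins-⊕-id {n} p zero = ⊕-id (suc n) p
  ins-⊕-id {suc n} p (suc j) = begin
    ((σ 1 1 ⊕ id n) ⨾ (id 1 ⊕ ins j)) ⊕ id p             ≈⟨ ⨾-⊕id p _ _ ⟩
    ((σ 1 1 ⊕ id n) ⊕ id p) ⨾ ((id 1 ⊕ ins j) ⊕ id p)     ≈⟨ ⨾-cong (⊕-assoc (σ 1 1) (id n) (id p))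
                                                                     (⊕-assoc (id 1) (ins j) (id p)) ⟩
    (σ 1 1 ⊕ (id n ⊕ id p)) ⨾ (id 1 ⊕ (ins j ⊕ id p))     ≈⟨ ⨾-cong (⊕-congˡ (⊕-id n p)) (⊕-congˡ (ins-⊕-id p j)) ⟩
    (σ 1 1 ⊕ id (n + p)) ⨾ (id 1 ⊕ ins (j ↑ˡ p))          ∎

  ⟨∣⟩-⊕ : ∀ {n p} {a a′ : Vec ℕ n} (c c′ : Vec ℕ p) → Distinct a → a ⊆ a′ →
          ⟨ a ∣ a′ ⟩ ⊕ ⟨ c ∣ c′ ⟩ ≈ ⟨ a ++ c ∣ a′ ++ c′ ⟩
  ⟨∣⟩-⊕ {a = []} {[]} c c′ _ _ = ⊕-unitˡ _
  ⟨∣⟩-⊕ {suc n} {p} {x ∷ xs} {a′} c c′ (x∉xs ∷ dxs) a⊆a′ = begin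
    ⟨ x ∷ xs ∣ a′ ⟩ ⊕ Q                        ≡⟨ cong (_⊕ Q) (⟨∷∣⟩-delete x xs a′ x↦j) ⟩
    ((id 1 ⊕ A) ⨾ ins j) ⊕ Q                   ≈⟨ ⊕-congˡ (idʳ Q) ⟨
    ((id 1 ⊕ A) ⨾ ins j) ⊕ (Q ⨾ id p)          ≈⟨ ⊕-⨾ _ _ _ _ ⟩
    ((id 1 ⊕ A) ⊕ Q) ⨾ (ins j ⊕ id p)          ≈⟨ ⨾-cong (⊕-assoc (id 1) A Q) (ins-⊕-id p j) ⟩
    (id 1 ⊕ (A ⊕ Q)) ⨾ ins (j ↑ˡ p)            ≈⟨ ⨾-congʳ (⊕-congˡ (⟨∣⟩-⊕ c c′ dxs xs⊆a′∖x)) ⟩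
    (id 1 ⊕ ⟨ xs ++ c ∣ delete x a′ ++ c′ ⟩) ⨾ ins (j ↑ˡ p)
      ≡⟨ cong (λ w → (id 1 ⊕ ⟨ xs ++ c ∣ w ⟩) ⨾ ins (j ↑ˡ p)) (delete-++ˡ a′ c′ x∈a′) ⟨
    (id 1 ⊕ ⟨ xs ++ c ∣ delete x (a′ ++ c′) ⟩) ⨾ ins (j ↑ˡ p)
      ≡⟨ ⟨∷∣⟩-delete x (xs ++ c) (a′ ++ c′) (indexOf-++ˡ a′ c′ x↦j) ⟨
    ⟨ x ∷ xs ++ c ∣ a′ ++ c′ ⟩                 ∎
    where
    x∈a′ = a⊆a′ (here refl)
    j = proj₁ (∈⇒indexOf x∈a′)
    x↦j = proj₂ (∈⇒indexOf x∈a′)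
    A = ⟨ xs ∣ delete x a′ ⟩
    Q = ⟨ c ∣ c′ ⟩
    xs⊆a′∖x : xs ⊆ delete x a′
    xs⊆a′∖x z∈ = ∈-delete⁺ a′ x∈a′ (a⊆a′ (there z∈)) (λ z≡x → x∉xs (subst (_∈ xs) z≡x z∈))

  ⟨∷∣∷ʳ⟩≈ins-last : ∀ {n x} (v : Vec ℕ n) → ¬ x ∈ v → ⟨ x ∷ v ∣ v ∷ʳ x ⟩ ≈ ins (fromℕ n)
  ⟨∷∣∷ʳ⟩≈ins-last {n} {x} v x∉v = begin
    ⟨ x ∷ v ∣ v ∷ʳ x ⟩                               ≡⟨ ⟨∷∣⟩-delete x v (v ∷ʳ x) (indexOf-∷ʳ v x∉v) ⟩
    (id 1 ⊕ ⟨ v ∣ delete x (v ∷ʳ x) ⟩) ⨾ ins (fromℕ n)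
      ≡⟨ cong (λ w → (id 1 ⊕ ⟨ v ∣ w ⟩) ⨾ ins (fromℕ n)) (delete-∷ʳ v x∉v) ⟩
    (id 1 ⊕ ⟨ v ∣ v ⟩) ⨾ ins (fromℕ n)               ≈⟨ ⨾-congʳ (≈.trans (⊕-congˡ (⟨∣⟩-refl v)) (⊕-id 1 n)) ⟩
    id _ ⨾ ins (fromℕ n)                             ≈⟨ idˡ _ ⟩
    ins (fromℕ n)                                    ∎

  subst₂-cong : ∀ {a b c d} (p : a ≡ b) (q : c ≡ d) {f g : Hom a c} → f ≈ g →
                subst₂ Hom p q f ≈ subst₂ Hom p q g
  subst₂-cong refl refl f≈g = f≈g

  subst-cong : ∀ {a c d} (q : c ≡ d) {f g : Hom a c} → f ≈ g → subst (Hom a) q f ≈ subst (Hom a) q g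
  subst-cong refl f≈g = f≈g

  subst₂-subst : ∀ {a b c d e} (p : a ≡ b) (q₁ : c ≡ d) (q₂ : c ≡ e) (f : Hom a c) →
                 subst₂ Hom p q₂ f ≡ subst₂ Hom p (trans (sym q₁) q₂) (subst (Hom a) q₁ f)
  subst₂-subst p refl refl f = refl

  subst₂-id : ∀ {a b c} (p : a ≡ b) (q : a ≡ c) (r : b ≡ c) →
              subst₂ Hom p q (id a) ≡ subst (Hom b) r (id b)
  subst₂-id refl refl r rewrite ≡-irrelevant r refl = refl

  subst₂-reflˡ : ∀ {a b b′} (r : b ≡ b′) (f : Hom a b) → subst₂ Hom refl r f ≡ subst (Hom a) r f
  subst₂-reflˡ refl f = refl

  id⊕-subst : ∀ {a b c} (r : b ≡ c) (f : Hom a b) →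
              id 1 ⊕ subst (Hom a) r f ≡ subst (Hom (suc a)) (cong suc r) (id 1 ⊕ f)
  id⊕-subst refl f = refl

  ⨾-subst : ∀ {a b c d} (f : Hom a b) (r : c ≡ d) (g : Hom b c) →
            f ⨾ subst (Hom b) r g ≡ subst (Hom a) r (f ⨾ g)
  ⨾-subst f refl g = refl

  perm : ∀ {k k′} → k ≡ k′ → Vec ℕ k → Vec ℕ k′ → Hom k k′
  perm refl u v = ⟨ u ∣ v ⟩

  perm-irrelevant : ∀ {k k′} (r r′ : k ≡ k′) u v → perm r u v ≡ perm r′ u v
  perm-irrelevant r r′ u v = cong (λ r″ → perm r″ u v) (≡-irrelevant r r′)

  perm-refl : ∀ {k} (r : k ≡ k) u v → perm r u v ≡ ⟨ u ∣ v ⟩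
  perm-refl r = perm-irrelevant r refl

  perm-self : ∀ {n} (r : n ≡ n) (v : Vec ℕ n) → perm r v v ≈ id n
  perm-self r v rewrite perm-refl r v v = ⟨∣⟩-refl v

  perm-trans : ∀ {k k′ k″} (r₁ : k ≡ k′) (r₂ : k′ ≡ k″) (r₃ : k ≡ k″) {u v w} →
               Distinct u → Distinct v → u ⊆ v → u ⊆ w → v ⊆ w →
               perm r₁ u v ⨾ perm r₂ v w ≈ perm r₃ u w
  perm-trans refl refl r₃ {u} {v} {w} du dv u⊆v u⊆w v⊆w
    rewrite perm-refl r₃ u w = ⟨∣⟩-trans du dv u⊆v u⊆w v⊆w

  perm-⊕ : ∀ {k k′ l l′} (r₁ : k ≡ k′) (r₂ : l ≡ l′) (r₃ : k + l ≡ k′ + l′) {u u′ v v′} →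
           Distinct u → u ⊆ u′ → perm r₁ u u′ ⊕ perm r₂ v v′ ≈ perm r₃ (u ++ v) (u′ ++ v′)
  perm-⊕ refl refl r₃ {u} {u′} {v} {v′} du u⊆u′
    rewrite perm-refl r₃ (u ++ v) (u′ ++ v′) = ⟨∣⟩-⊕ v v′ du u⊆u′

  perm-trans-Enum : ∀ {k k′ k″ A} (u : Vec ℕ k) (v : Vec ℕ k′) (w : Vec ℕ k″) →
                    Enum u A → Enum v A → Enum w A →
                    (r₁ : k ≡ k′) (r₂ : k′ ≡ k″) (r₃ : k ≡ k″) → perm r₁ u v ⨾ perm r₂ v w ≈ perm r₃ u w
  perm-trans-Enum u v w eu ev ew r₁ r₂ r₃ =
    perm-trans r₁ r₂ r₃ (Enum⇒Distinct u eu) (Enum⇒Distinct v ev)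
               (Enum⇒⊆ u v eu ev) (Enum⇒⊆ u w eu ew) (Enum⇒⊆ v w ev ew)

  perm-⊕-Enum : ∀ {k k′ l l′ A} (u : Vec ℕ k) (u′ : Vec ℕ k′) {v : Vec ℕ l} {v′ : Vec ℕ l′} →
                Enum u A → Enum u′ A → (r₁ : k ≡ k′) (r₂ : l ≡ l′) (r₃ : k + l ≡ k′ + l′) →
                perm r₁ u u′ ⊕ perm r₂ v v′ ≈ perm r₃ (u ++ v) (u′ ++ v′)
  perm-⊕-Enum u u′ eu eu′ r₁ r₂ r₃ = perm-⊕ r₁ r₂ r₃ (Enum⇒Distinct u eu) (Enum⇒⊆ u u′ eu eu′)

  subst-perm : ∀ {k k′ k″} (r : k ≡ k′) (q : k′ ≡ k″) u v →
               subst (Hom k) q (perm r u v) ≡ perm (trans r q) u (subst (Vec ℕ) q v)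
  subst-perm refl refl u v = refl

  σ-0ˡ : ∀ k (r : k ≡ k + 0) → σ 0 k ≈ subst (Hom k) r (id k)
  σ-0ˡ k r = begin
    σ 0 k                                                     ≈⟨ ⊕-unitʳ (σ 0 k) ⟨
    subst₂ Hom (+-identityʳ k) (+-identityʳ (k + 0)) (σ 0 k ⊕ id 0)
      ≡⟨ subst₂-subst (+-identityʳ k) (+-assoc k 0 0) (+-identityʳ (k + 0)) _ ⟩
    subst₂ Hom (+-identityʳ k) q X                            ≈⟨ subst₂-cong (+-identityʳ k) q X≈id ⟩
    subst₂ Hom (+-identityʳ k) q (id (k + 0))                 ≡⟨ subst₂-id (+-identityʳ k) q r ⟩
    subst (Hom k) r (id k)                                    ∎
    where
    X = subst (Hom (k + 0)) (+-assoc k 0 0) (σ 0 k ⊕ id 0)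
    q = trans (sym (+-assoc k 0 0)) (+-identityʳ (k + 0))
    σ≈σ⨾X : σ 0 k ≈ σ 0 k ⨾ X
    σ≈σ⨾X = ≈.trans (σ-hex 0 0 k) (⨾-cong (⊕-unitˡ (σ 0 k)) (≡⇒≈ (subst₂-reflˡ (+-assoc k 0 0) _)))
    X≈id : X ≈ id (k + 0)
    X≈id = begin
      X                       ≈⟨ idˡ X ⟨
      id _ ⨾ X                ≈⟨ ⨾-congʳ (σ-inv k 0) ⟨
      (σ k 0 ⨾ σ 0 k) ⨾ X     ≈⟨ assoc _ _ _ ⟩
      σ k 0 ⨾ (σ 0 k ⨾ X)     ≈⟨ ⨾-congˡ σ≈σ⨾X ⟨
      σ k 0 ⨾ σ 0 k           ≈⟨ σ-inv k 0 ⟩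
      id _                    ∎

  σ-1-suc : ∀ n → σ 1 (suc n) ≈ swap₀₁ n ⨾ (id 1 ⊕ σ 1 n)
  σ-1-suc n = begin
    σ 1 (suc n)                               ≈⟨ idʳ _ ⟨
    σ 1 (suc n) ⨾ id _                        ≈⟨ ⨾-congˡ inverse ⟨
    σ 1 (suc n) ⨾ (σ (suc n) 1 ⨾ X)           ≈⟨ assoc˘ _ _ _ ⟩
    (σ 1 (suc n) ⨾ σ (suc n) 1) ⨾ X           ≈⟨ ⨾-congʳ (σ-inv 1 (suc n)) ⟩
    id _ ⨾ X                                  ≈⟨ idˡ X ⟩
    X                                         ∎
    where
    X = swap₀₁ n ⨾ (id 1 ⊕ σ 1 n)
    inverse : σ (suc n) 1 ⨾ X ≈ id _
    inverse = begin
      σ (suc n) 1 ⨾ X                                       ≈⟨ ⨾-congʳ (σ-hex 1 n 1) ⟩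
      ((id 1 ⊕ σ n 1) ⨾ swap₀₁ n) ⨾ (swap₀₁ n ⨾ (id 1 ⊕ σ 1 n)) ≈⟨ assoc _ _ _ ⟩
      (id 1 ⊕ σ n 1) ⨾ (swap₀₁ n ⨾ (swap₀₁ n ⨾ (id 1 ⊕ σ 1 n))) ≈⟨ ⨾-congˡ (assoc˘ _ _ _) ⟩
      (id 1 ⊕ σ n 1) ⨾ ((swap₀₁ n ⨾ swap₀₁ n) ⨾ (id 1 ⊕ σ 1 n)) ≈⟨ ⨾-congˡ (⨾-congʳ (swap₀₁-involutive n)) ⟩
      (id 1 ⊕ σ n 1) ⨾ (id _ ⨾ (id 1 ⊕ σ 1 n))                 ≈⟨ ⨾-congˡ (idˡ _) ⟩
      (id 1 ⊕ σ n 1) ⨾ (id 1 ⊕ σ 1 n)                          ≈⟨ id⊕-⨾ 1 _ _ ⟨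
      id 1 ⊕ (σ n 1 ⨾ σ 1 n)                                   ≈⟨ ⊕-congˡ (σ-inv n 1) ⟩
      id 1 ⊕ id (n + 1)                                        ≈⟨ ⊕-id 1 _ ⟩
      id _                                                     ∎

  σ-1≈ins-last : ∀ n (r : suc n ≡ n + 1) → σ 1 n ≈ subst (Hom (suc n)) r (ins (fromℕ n))
  σ-1≈ins-last zero r rewrite ≡-irrelevant r refl = begin
    σ 1 0                ≈⟨ idʳ _ ⟨
    σ 1 0 ⨾ id 1         ≈⟨ ⨾-congˡ (σ-0ˡ 1 refl) ⟨
    σ 1 0 ⨾ σ 0 1        ≈⟨ σ-inv 1 0 ⟩
    id 1                 ∎
  σ-1≈ins-last (suc n) r = begin
    σ 1 (suc n)                                                   ≈⟨ σ-1-suc n ⟩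
    swap₀₁ n ⨾ (id 1 ⊕ σ 1 n)                                     ≈⟨ ⨾-congˡ (⊕-congˡ (σ-1≈ins-last n r′)) ⟩
    swap₀₁ n ⨾ (id 1 ⊕ subst (Hom (suc n)) r′ (ins (fromℕ n)))    ≡⟨ cong (swap₀₁ n ⨾_) (id⊕-subst r′ _) ⟩
    swap₀₁ n ⨾ subst (Hom (2 + n)) (cong suc r′) (id 1 ⊕ ins (fromℕ n))
                                                                  ≡⟨ ⨾-subst (swap₀₁ n) (cong suc r′) _ ⟩
    subst (Hom (2 + n)) (cong suc r′) (swap₀₁ n ⨾ (id 1 ⊕ ins (fromℕ n)))
      ≡⟨ cong (λ r″ → subst (Hom (2 + n)) r″ (swap₀₁ n ⨾ (id 1 ⊕ ins (fromℕ n)))) (≡-irrelevant _ r) ⟩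
    subst (Hom (2 + n)) r (ins (fromℕ (suc n)))                   ∎
    where r′ = suc-injective r

  σ≈perm : ∀ {m n} (u : Vec ℕ m) (v : Vec ℕ n) (r : m + n ≡ n + m) → Distinct (u ++ v) →
           σ m n ≈ perm r (u ++ v) (v ++ u)
  σ≈perm {zero} {n} [] v r _ = begin
    σ 0 n                                ≈⟨ σ-0ˡ n r ⟩
    subst (Hom n) r (id n)               ≈⟨ subst-cong r (⟨∣⟩-refl v) ⟨
    subst (Hom n) r ⟨ v ∣ v ⟩            ≡⟨ subst-perm refl r v v ⟩
    perm r v (subst (Vec ℕ) r v)         ≡⟨ cong (perm r v) (subst-++-[] v r) ⟩
    perm r v (v ++ [])                   ∎
  σ≈perm {suc m} {n} (x ∷ u) v r (x∉ ∷ d) = begin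
    σ (suc m) n                                        ≈⟨ σ-hex 1 m n ⟩
    (id 1 ⊕ σ m n) ⨾ subst₂ Hom refl q (σ 1 n ⊕ id m)  ≈⟨ ⨾-cong tail-swap (subst₂-cong refl q head-swap) ⟩
    perm (cong suc r′) xuv xvu ⨾ subst₂ Hom refl q (perm r₁₃ xvu (xv′ ++ u))
                                                       ≡⟨ cong (perm (cong suc r′) xuv xvu ⨾_) transport ⟩
    perm (cong suc r′) xuv xvu ⨾ perm (trans r₁₃ q) xvu vxu
      ≈⟨ perm-trans (cong suc r′) (trans r₁₃ q) r (x∉ ∷ d) dxvu xuv⊆xvu xuv⊆vxu xvu⊆vxu ⟩
    perm r xuv vxu                                     ∎
    where
    q = +-assoc n 1 m
    r′ = +-comm m n
    r₁ = +-comm 1 n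
    r₁₃ = cong (_+ m) r₁
    xv′ = subst (Vec ℕ) r₁ (v ∷ʳ x)
    xuv = x ∷ u ++ v
    xvu = x ∷ v ++ u
    vxu = v ++ x ∷ u
    x∉v : ¬ x ∈ v
    x∉v x∈v = x∉ (Any.++⁺ʳ u x∈v)
    tail-swap : id 1 ⊕ σ m n ≈ perm (cong suc r′) xuv xvu
    tail-swap = begin
      id 1 ⊕ σ m n                                  ≈⟨ ⊕-cong (≈.sym (⟨∣⟩-refl (x ∷ []))) (σ≈perm u v r′ d) ⟩
      perm refl (x ∷ []) (x ∷ []) ⊕ perm r′ (u ++ v) (v ++ u)
                                                    ≈⟨ perm-⊕ refl r′ (cong suc r′) ((λ ()) ∷ []) (λ z∈ → z∈) ⟩
      perm (cong suc r′) xuv xvu                    ∎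
    head-swap : σ 1 n ⊕ id m ≈ perm r₁₃ xvu (xv′ ++ u)
    head-swap = begin
      σ 1 n ⊕ id m                                  ≈⟨ ⊕-cong σ-1≈perm (≈.sym (⟨∣⟩-refl u)) ⟩
      perm r₁ (x ∷ v) xv′ ⊕ perm refl u u           ≈⟨ perm-⊕ r₁ refl r₁₃ (x∉v ∷ Distinct-++⁻ʳ u d)
                                                               (λ z∈ → ∈-subst r₁ (∈-∷ʳ v z∈)) ⟩
      perm r₁₃ xvu (xv′ ++ u)                       ∎
      where
      σ-1≈perm : σ 1 n ≈ perm r₁ (x ∷ v) xv′
      σ-1≈perm = begin
        σ 1 n                                      ≈⟨ σ-1≈ins-last n r₁ ⟩
        subst (Hom (suc n)) r₁ (ins (fromℕ n))     ≈⟨ subst-cong r₁ (⟨∷∣∷ʳ⟩≈ins-last v x∉v) ⟨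
        subst (Hom (suc n)) r₁ ⟨ x ∷ v ∣ v ∷ʳ x ⟩  ≡⟨ subst-perm refl r₁ (x ∷ v) (v ∷ʳ x) ⟩
        perm r₁ (x ∷ v) xv′                        ∎
    transport : subst₂ Hom refl q (perm r₁₃ xvu (xv′ ++ u)) ≡ perm (trans r₁₃ q) xvu vxu
    transport = trans (subst₂-reflˡ q _)
                      (trans (subst-perm r₁₃ q xvu (xv′ ++ u))
                             (cong (perm (trans r₁₃ q) xvu) (subst-∷ʳ-++ v x u r₁ q)))
    dxvu : Distinct xvu
    dxvu = (λ x∈ → x∉ (Any.++-comm v u x∈)) ∷ Distinct-++-comm u v d
    xuv⊆xvu : xuv ⊆ xvu
    xuv⊆xvu (here eq)  = here eq
    xuv⊆xvu (there z∈) = there (Any.++-comm u v z∈)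
    xuv⊆vxu : xuv ⊆ vxu
    xuv⊆vxu (here eq)  = Any.++⁺ʳ v (here eq)
    xuv⊆vxu (there z∈) with Any.++⁻ u z∈
    ... | inj₁ z∈u = Any.++⁺ʳ v (there z∈u)
    ... | inj₂ z∈v = Any.++⁺ˡ z∈v
    xvu⊆vxu : xvu ⊆ vxu
    xvu⊆vxu (here eq)  = Any.++⁺ʳ v (here eq)
    xvu⊆vxu (there z∈) with Any.++⁻ v z∈
    ... | inj₁ z∈v = Any.++⁺ˡ z∈v
    ... | inj₂ z∈u = Any.++⁺ʳ v (there z∈u)

standardNames : ∀ n → Vec ℕ n
standardNames zero    = []
standardNames (suc n) = 0 ∷ map suc (standardNames n)

length≡card-standardNames : ∀ n → n ≡ card (set (standardNames n))
length≡card-standardNames zero    = refl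
length≡card-standardNames (suc n) rewrite set-map-suc (standardNames n) =
  trans (cong suc (length≡card-standardNames n)) (sym (card-0-shift (set (standardNames n))))
  where
  card-0-shift : ∀ A → card (ne one ∪ shift A) ≡ suc (card A)
  card-0-shift ∅      = refl
  card-0-shift (ne _) = refl

standardNames-Enum : ∀ n → Enum (standardNames n) (set (standardNames n))
standardNames-Enum n = refl , length≡card-standardNames n

module Representation {c ℓ : Level} (S : PROP c ℓ) where
  open PROPProperties S
  open PermutationLemmas S
  open ≈-Reasoning

  NomS = NOM S
  module NomS = NomPROP NomS

  η : ∀ {n m} → Hom n m → ORDHom NomS n m
  η {n} {m} f =
    ⟨ standardNames n ] ([ standardNames n ⟩ f ⟨ standardNames m ] {standardNames-Enum n} {standardNames-Enum m})
    [ standardNames m ⟩ {standardNames-Enum n} {standardNames-Enum m}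

  decode : ∀ {n m} → ORDHom NomS n m → Hom n m
  decode (⟨ a ] ([ a₁ ⟩ g ⟨ b₁ ] {ea₁} {eb₁}) [ b ⟩ {ea} {eb}) =
    perm (Enum-length a a₁ ea ea₁) a a₁ ⨾ (g ⨾ perm (Enum-length b₁ b eb₁ eb) b₁ b)

  -- The arrow that NOM(S) composition inserts between the two components.
  reindexed : ∀ {n n₁ k} → n ≡ n₁ → Vec ℕ n → Vec ℕ n₁ → Hom n₁ k → Hom n k
  reindexed p u u₁ g = ⟨ u ∣ subst (Vec ℕ) (sym p) u₁ ⟩ ⨾ subst (λ x → Hom x _) (sym p) g

  reindexed≡perm : ∀ {n n₁ k} (p : n ≡ n₁) (u : Vec ℕ n) (u₁ : Vec ℕ n₁) (g : Hom n₁ k) →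
                   reindexed p u u₁ g ≡ perm p u u₁ ⨾ g
  reindexed≡perm refl u u₁ g = refl

  decode-η : ∀ {n m} (f : Hom n m) → decode (η f) ≈ f
  decode-η {n} {m} f = begin
    decode (η f)        ≈⟨ ⨾-cong (perm-self (self-length n) (standardNames n))
                                  (⨾-congˡ (perm-self (self-length m) (standardNames m))) ⟩
    id n ⨾ (f ⨾ id m)   ≈⟨ idˡ _ ⟩
    f ⨾ id m            ≈⟨ idʳ f ⟩
    f                   ∎
    where
    self-length : ∀ k → k ≡ k
    self-length k = Enum-length (standardNames k) (standardNames k) (standardNames-Enum k) (standardNames-Enum k)

  decode-Enum-irrelevant :
    ∀ {n m A B} (a : Vec ℕ n) (b : Vec ℕ m) (h : NOMHom S A B) ea ea′ eb eb′ →
    decode (⟨ a ] h [ b ⟩ {ea} {eb}) ≈ decode (⟨ a ] h [ b ⟩ {ea′} {eb′})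
  decode-Enum-irrelevant a b ([ a₁ ⟩ g ⟨ b₁ ] {ea₁} {eb₁}) ea ea′ eb eb′
    rewrite perm-irrelevant (Enum-length a a₁ ea ea₁) (Enum-length a a₁ ea′ ea₁) a a₁
          | perm-irrelevant (Enum-length b₁ b eb₁ eb) (Enum-length b₁ b eb₁ eb′) b₁ b = ≈.refl

  decode-resp-NOM≈ : ∀ {n m A B} (a : Vec ℕ n) (b : Vec ℕ m) ea eb {h h′ : NOMHom S A B} →
                     NOM≈ S h h′ → decode (⟨ a ] h [ b ⟩ {ea} {eb}) ≈ decode (⟨ a ] h′ [ b ⟩ {ea} {eb})
  decode-resp-NOM≈ a b ea eb (nom-mid {a = a₁} {b = b₁} {ea = ea₁} {ea₁′} {eb₁} {eb₁′} g≈g′)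
    rewrite perm-irrelevant (Enum-length a a₁ ea ea₁) (Enum-length a a₁ ea ea₁′) a a₁
          | perm-irrelevant (Enum-length b₁ b eb₁ eb) (Enum-length b₁ b eb₁′ eb) b₁ b =
    ⨾-congˡ (⨾-congʳ g≈g′)
  decode-resp-NOM≈ a b ea eb (nom-permL {a = a₁} {a₁′} {b₁} {f} {ea₁} {ea₁′} {eb₁} {eb₁′})
    rewrite perm-irrelevant (Enum-length b₁ b eb₁ eb) (Enum-length b₁ b eb₁′ eb) b₁ b = begin
    Pa ⨾ ((⟨ a₁ ∣ a₁′ ⟩ ⨾ f) ⨾ Q)                ≈⟨ ⨾-congˡ (assoc _ _ _) ⟩
    Pa ⨾ (⟨ a₁ ∣ a₁′ ⟩ ⨾ (f ⨾ Q))                ≈⟨ assoc˘ _ _ _ ⟩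
    (Pa ⨾ perm refl a₁ a₁′) ⨾ (f ⨾ Q)
      ≈⟨ ⨾-congʳ (perm-trans-Enum a a₁ a₁′ ea ea₁ ea₁′
                                    (Enum-length a a₁ ea ea₁) refl (Enum-length a a₁′ ea ea₁′)) ⟩
    perm (Enum-length a a₁′ ea ea₁′) a a₁′ ⨾ (f ⨾ Q) ∎
    where
    Pa = perm (Enum-length a a₁ ea ea₁) a a₁
    Q = perm (Enum-length b₁ b eb₁′ eb) b₁ b
  decode-resp-NOM≈ a b ea eb (nom-permR {a = a₁} {b₁} {b₁′} {f} {ea₁} {ea₁′} {eb₁} {eb₁′})
    rewrite perm-irrelevant (Enum-length a a₁ ea ea₁) (Enum-length a a₁ ea ea₁′) a a₁ = ⨾-congˡ (begin
    (f ⨾ ⟨ b₁ ∣ b₁′ ⟩) ⨾ perm (Enum-length b₁′ b eb₁ eb) b₁′ b    ≈⟨ assoc _ _ _ ⟩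
    f ⨾ (perm refl b₁ b₁′ ⨾ perm (Enum-length b₁′ b eb₁ eb) b₁′ b)
      ≈⟨ ⨾-congˡ (perm-trans-Enum b₁ b₁′ b eb₁′ eb₁ eb
                                    refl (Enum-length b₁′ b eb₁ eb) (Enum-length b₁ b eb₁′ eb)) ⟩
    f ⨾ perm (Enum-length b₁ b eb₁′ eb) b₁ b                     ∎)
  decode-resp-NOM≈ a b ea eb nom-refl          = ≈.refl
  decode-resp-NOM≈ a b ea eb (nom-sym h≈)      = ≈.sym (decode-resp-NOM≈ a b ea eb h≈)
  decode-resp-NOM≈ a b ea eb (nom-trans h≈ h≈′) =
    ≈.trans (decode-resp-NOM≈ a b ea eb h≈) (decode-resp-NOM≈ a b ea eb h≈′)

  decode-resp-ORD≈ : ∀ {n m} {h h′ : ORDHom NomS n m} → ORD≈ NomS h h′ → decode h ≈ decode h′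
  decode-resp-ORD≈ (ord-mid {a = a} {b} {f} {g} {ea} {ea′} {eb} {eb′} f≈g) =
    ≈.trans (decode-resp-NOM≈ a b ea eb f≈g) (decode-Enum-irrelevant a b g ea ea′ eb eb′)
  decode-resp-ORD≈ {n} (ord-moveL {a = a} {b} {c} {[ b₁ ⟩ g ⟨ c₁ ] {eb₁} {ec₁}} {ea} {eb} {ea′} {eb′} {ec} {ec′}) =
    begin
    perm (Enum-length a a ea′ ea) a a ⨾ ((id n ⨾ reindexed p b b₁ g) ⨾ Q)
      ≈⟨ ⨾-congʳ (perm-self (Enum-length a a ea′ ea) a) ⟩
    id n ⨾ ((id n ⨾ reindexed p b b₁ g) ⨾ Q)
      ≈⟨ ≈.trans (idˡ _) (⨾-congʳ (idˡ _)) ⟩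
    reindexed p b b₁ g ⨾ Q
      ≡⟨ cong (_⨾ Q) (reindexed≡perm p b b₁ g) ⟩
    (perm p b b₁ ⨾ g) ⨾ Q                                               ≈⟨ assoc _ _ _ ⟩
    perm p b b₁ ⨾ (g ⨾ Q)
      ≡⟨ cong₂ (λ P₁ P₂ → P₁ ⨾ (g ⨾ P₂)) (perm-irrelevant p (Enum-length b b₁ eb′ eb₁) b b₁)
                                      (perm-irrelevant (Enum-length c₁ c ec₁ ec) (Enum-length c₁ c ec₁ ec′) c₁ c) ⟩
    perm (Enum-length b b₁ eb′ eb₁) b b₁ ⨾ (g ⨾ perm (Enum-length c₁ c ec₁ ec′) c₁ c) ∎
    where
    p = Enum-length b b₁ eb eb₁
    Q = perm (Enum-length c₁ c ec₁ ec) c₁ c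
  decode-resp-ORD≈ {n} {m} (ord-moveR {a = a} {b} {c} {[ a₁ ⟩ g ⟨ b₁ ] {ea₁} {eb₁}} {eb} {ec} {ea} {ea′} {eb′} {ec′}) =
    begin
    Pa ⨾ ((g ⨾ reindexed p b₁ b (id m)) ⨾ perm (Enum-length c c ec ec′) c c)
      ≈⟨ ⨾-congˡ (≈.trans (⨾-congˡ (perm-self (Enum-length c c ec ec′) c)) (idʳ _)) ⟩
    Pa ⨾ (g ⨾ reindexed p b₁ b (id m))
      ≡⟨ cong (λ h → Pa ⨾ (g ⨾ h)) (reindexed≡perm p b₁ b (id m)) ⟩
    Pa ⨾ (g ⨾ (perm p b₁ b ⨾ id m))                                     ≈⟨ ⨾-congˡ (⨾-congˡ (idʳ _)) ⟩
    Pa ⨾ (g ⨾ perm p b₁ b)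
      ≡⟨ cong₂ (λ P₁ P₂ → P₁ ⨾ (g ⨾ P₂)) (perm-irrelevant (Enum-length a a₁ ea ea₁) (Enum-length a a₁ ea′ ea₁) a a₁)
                                      (perm-irrelevant p (Enum-length b₁ b eb₁ eb′) b₁ b) ⟩
    perm (Enum-length a a₁ ea′ ea₁) a a₁ ⨾ (g ⨾ perm (Enum-length b₁ b eb₁ eb′) b₁ b) ∎
    where
    p = Enum-length b₁ b eb₁ eb
    Pa = perm (Enum-length a a₁ ea ea₁) a a₁
  decode-resp-ORD≈ ord-refl             = ≈.refl
  decode-resp-ORD≈ (ord-sym h≈)         = ≈.sym (decode-resp-ORD≈ h≈)
  decode-resp-ORD≈ (ord-trans h≈ h≈′)   = ≈.trans (decode-resp-ORD≈ h≈) (decode-resp-ORD≈ h≈′)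

  η-rename : ∀ {n m A B} (a : Vec ℕ n) (b : Vec ℕ m) (ea : Enum a A) (eb : Enum b B) (f : Hom n m) →
             ORD≈ NomS (⟨ a ] ([ a ⟩ f ⟨ b ] {ea} {eb}) [ b ⟩ {ea} {eb}) (η f)
  η-rename {n} {m} a b ea eb f =
    ord-trans (ord-sym (ord-moveL {a = cn} {b = a} {c = b} {f = [ a ⟩ f ⟨ b ] {ea} {eb}}
                                  {ea = ecn} {eb = ea} {ea' = ecn} {eb' = ea} {ec = eb} {ec' = eb}))
   (ord-trans (ord-mid {ea' = ecn} {eb' = eb} (nom-mid {ea' = ecn} {eb' = eb} rename-domain))
   (ord-trans (ord-mid (nom-mid (≈.sym rename-codomain)))
              (ord-moveR {a = cn} {b = cm} {c = b} {f = [ cn ⟩ f ⟨ cm ] {ecn} {ecm}}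
                         {eb = ecm} {ec = eb} {ea = ecn} {ea' = ecn} {eb' = ecm} {ec' = eb})))
    where
    cn = standardNames n
    cm = standardNames m
    ecn = standardNames-Enum n
    ecm = standardNames-Enum m
    p = Enum-length a a ea ea
    q = Enum-length cm cm ecm ecm
    rename-domain : id n ⨾ reindexed p a a f ≈ f
    rename-domain = begin
      id n ⨾ reindexed p a a f  ≈⟨ idˡ _ ⟩
      reindexed p a a f         ≡⟨ reindexed≡perm p a a f ⟩
      perm p a a ⨾ f            ≈⟨ ⨾-congʳ (perm-self p a) ⟩
      id n ⨾ f                  ≈⟨ idˡ f ⟩
      f                         ∎
    rename-codomain : f ⨾ reindexed q cm cm (id m) ≈ f
    rename-codomain = begin
      f ⨾ reindexed q cm cm (id m) ≡⟨ cong (f ⨾_) (reindexed≡perm q cm cm (id m)) ⟩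
      f ⨾ (perm q cm cm ⨾ id m)  ≈⟨ ⨾-congˡ (≈.trans (idʳ _) (perm-self q cm)) ⟩
      f ⨾ id m                   ≈⟨ idʳ f ⟩
      f                          ∎

  η-decode : ∀ {n m} (h : ORDHom NomS n m) → ORD≈ NomS h (η (decode h))
  η-decode {n} {m} (⟨ a ] ([ a₁ ⟩ g ⟨ b₁ ] {ea₁} {eb₁}) [ b ⟩ {ea} {eb}) =
    ord-trans (ord-sym (ord-moveL {a = a} {b = a} {c = b} {f = [ a₁ ⟩ g ⟨ b₁ ] {ea₁} {eb₁}}
                                  {ea = ea} {eb = ea} {ea' = ea} {eb' = ea} {ec = eb} {ec' = eb}))
   (ord-trans (ord-mid (nom-mid rename-domain))
   (ord-trans (ord-sym (ord-moveR {a = a} {b = b} {c = b} {f = [ a ⟩ Pa ⨾ g ⟨ b₁ ] {ea} {eb₁}}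
                                  {eb = eb} {ec = eb} {ea = ea} {ea' = ea} {eb' = eb} {ec' = eb}))
   (ord-trans (ord-mid (nom-mid rename-codomain))
              (η-rename a b ea eb (Pa ⨾ (g ⨾ Pb))))))
    where
    p = Enum-length a a₁ ea ea₁
    q = Enum-length b₁ b eb₁ eb
    Pa = perm p a a₁
    Pb = perm q b₁ b
    rename-domain : id n ⨾ reindexed p a a₁ g ≈ Pa ⨾ g
    rename-domain = ≈.trans (idˡ _) (≡⇒≈ (reindexed≡perm p a a₁ g))
    rename-codomain : (Pa ⨾ g) ⨾ reindexed q b₁ b (id m) ≈ Pa ⨾ (g ⨾ Pb)
    rename-codomain = begin
      (Pa ⨾ g) ⨾ reindexed q b₁ b (id m) ≡⟨ cong ((Pa ⨾ g) ⨾_) (reindexed≡perm q b₁ b (id m)) ⟩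
      (Pa ⨾ g) ⨾ (Pb ⨾ id m)   ≈⟨ ⨾-congˡ (idʳ _) ⟩
      (Pa ⨾ g) ⨾ Pb            ≈⟨ assoc _ _ _ ⟩
      Pa ⨾ (g ⨾ Pb)            ∎

  η-by-decode : ∀ {n m} {f : Hom n m} (h : ORDHom NomS n m) → decode h ≈ f → ORD≈ NomS (η f) h
  η-by-decode h decode≈f = ord-trans (ord-mid (nom-mid (≈.sym decode≈f))) (ord-sym (η-decode h))

  decode-resp-η : ∀ {n m} {f : Hom n m} {h : ORDHom NomS n m} → ORD≈ NomS (η f) h → f ≈ decode h
  decode-resp-η {f = f} η≈h = ≈.trans (≈.sym (decode-η f)) (decode-resp-ORD≈ η≈h)

  η-preserves-id : ∀ n {A} (a : Vec ℕ n) (ea : Enum a A) →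
                   ORD≈ NomS (η (id n)) (⟨ a ] NomS.id A [ a ⟩ {ea} {ea})
  η-preserves-id n {A} a ea = η-by-decode (⟨ a ] NomS.id A [ a ⟩ {ea} {ea}) (begin
    perm (Enum-length a E ea eE) a E ⨾ (id _ ⨾ perm (Enum-length E a eE ea) E a) ≈⟨ ⨾-congˡ (idˡ _) ⟩
    perm (Enum-length a E ea eE) a E ⨾ perm (Enum-length E a eE ea) E a
      ≈⟨ perm-trans-Enum a E a ea eE ea (Enum-length a E ea eE) (Enum-length E a eE ea) refl ⟩
    ⟨ a ∣ a ⟩                                                                 ≈⟨ ⟨∣⟩-refl a ⟩
    id n                                                                      ∎)
    where
    E = enum A
    eE = enum-Enum A

  η-preserves-⨾ : ∀ {l m n} (f : Hom l m) (g : Hom m n) {A B C}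
                  (a : Vec ℕ l) (b : Vec ℕ m) (c : Vec ℕ n)
                  (f′ : NomS.Hom A B) (g′ : NomS.Hom B C) {ea eb eb′ ec} →
                  ORD≈ NomS (η f) (⟨ a ] f′ [ b ⟩ {ea} {eb}) →
                  ORD≈ NomS (η g) (⟨ b ] g′ [ c ⟩ {eb′} {ec}) →
                  ORD≈ NomS (η (f ⨾ g)) (⟨ a ] f′ NomS.⨾ g′ [ c ⟩ {ea} {ec})
  η-preserves-⨾ f g a b c f′@([ a₁ ⟩ f₁ ⟨ b₁ ] {ea₁} {eb₁}) g′@([ b₂ ⟩ g₁ ⟨ c₂ ] {eb₂} {ec₂})
                {ea} {eb} {eb′} {ec} ηf≈ ηg≈ =
    η-by-decode (⟨ a ] f′ NomS.⨾ g′ [ c ⟩ {ea} {ec}) (begin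
    Pa ⨾ ((f₁ ⨾ reindexed p b₁ b₂ g₁) ⨾ Pc)   ≡⟨ cong (λ h → Pa ⨾ ((f₁ ⨾ h) ⨾ Pc)) (reindexed≡perm p b₁ b₂ g₁) ⟩
    Pa ⨾ ((f₁ ⨾ (perm p b₁ b₂ ⨾ g₁)) ⨾ Pc)    ≈⟨ ⨾-congˡ (≈.trans (assoc _ _ _) (⨾-congˡ (assoc _ _ _))) ⟩
    Pa ⨾ (f₁ ⨾ (perm p b₁ b₂ ⨾ (g₁ ⨾ Pc)))
      ≈⟨ ⨾-congˡ (⨾-congˡ (⨾-congʳ (perm-trans-Enum b₁ b b₂ eb₁ eb eb₂
                                      (Enum-length b₁ b eb₁ eb) (Enum-length b b₂ eb′ eb₂) p))) ⟨
    Pa ⨾ (f₁ ⨾ ((Pb ⨾ Pb′) ⨾ (g₁ ⨾ Pc)))      ≈⟨ ⨾-congˡ (⨾-congˡ (assoc _ _ _)) ⟩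
    Pa ⨾ (f₁ ⨾ (Pb ⨾ (Pb′ ⨾ (g₁ ⨾ Pc))))      ≈⟨ ≈.trans (⨾-congˡ (assoc˘ _ _ _)) (assoc˘ _ _ _) ⟩
    (Pa ⨾ (f₁ ⨾ Pb)) ⨾ (Pb′ ⨾ (g₁ ⨾ Pc))      ≈⟨ ⨾-cong (decode-resp-η ηf≈) (decode-resp-η ηg≈) ⟨
    f ⨾ g                                     ∎)
    where
    p = Enum-length b₁ b₂ eb₁ eb₂
    Pa = perm (Enum-length a a₁ ea ea₁) a a₁
    Pb = perm (Enum-length b₁ b eb₁ eb) b₁ b
    Pb′ = perm (Enum-length b b₂ eb′ eb₂) b b₂
    Pc = perm (Enum-length c₂ c ec₂ ec) c₂ c

  η-preserves-⊕ : ∀ {m n p q} (f : Hom m n) (g : Hom p q) {A B C D}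
                  (a : Vec ℕ m) (b : Vec ℕ n) (c : Vec ℕ p) (d : Vec ℕ q)
                  (f′ : NomS.Hom A B) (g′ : NomS.Hom C D)
                  (dAC : Disjoint A C) (dBD : Disjoint B D) {ea eb ec ed eac ebd} →
                  ORD≈ NomS (η f) (⟨ a ] f′ [ b ⟩ {ea} {eb}) →
                  ORD≈ NomS (η g) (⟨ c ] g′ [ d ⟩ {ec} {ed}) →
                  ORD≈ NomS (η (f ⊕ g)) (⟨ a ++ c ] NomS.tensor f′ g′ dAC dBD [ b ++ d ⟩ {eac} {ebd})
  η-preserves-⊕ f g a b c d f′@([ a₁ ⟩ f₁ ⟨ b₁ ] {ea₁} {eb₁}) g′@([ c₁ ⟩ g₁ ⟨ d₁ ] {ec₁} {ed₁}) dAC dBD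
                {ea} {eb} {ec} {ed} {eac} {ebd} ηf≈ ηg≈ =
    η-by-decode (⟨ a ++ c ] f′⊎g′ [ b ++ d ⟩ {eac} {ebd}) (≈.sym (begin
    f ⊕ g                                         ≈⟨ ⊕-cong (decode-resp-η ηf≈) (decode-resp-η ηg≈) ⟩
    (Pa ⨾ (f₁ ⨾ Pb)) ⊕ (Pc ⨾ (g₁ ⨾ Pd))           ≈⟨ ≈.trans (⊕-⨾ _ _ _ _) (⨾-congˡ (⊕-⨾ _ _ _ _)) ⟩
    (Pa ⊕ Pc) ⨾ ((f₁ ⊕ g₁) ⨾ (Pb ⊕ Pd))
      ≈⟨ ⨾-cong (perm-⊕-Enum a a₁ {c} {c₁} ea ea₁ (Enum-length a a₁ ea ea₁) (Enum-length c c₁ ec ec₁)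
                           (Enum-length (a ++ c) (a₁ ++ c₁) eac (NOMHom.ea f′⊎g′)))
                (⨾-congˡ (perm-⊕-Enum b₁ b {d₁} {d} eb₁ eb (Enum-length b₁ b eb₁ eb) (Enum-length d₁ d ed₁ ed)
                                      (Enum-length (b₁ ++ d₁) (b ++ d) (NOMHom.eb f′⊎g′) ebd))) ⟩
    decode (⟨ a ++ c ] f′⊎g′ [ b ++ d ⟩ {eac} {ebd}) ∎))
    where
    f′⊎g′ = NomS.tensor f′ g′ dAC dBD
    Pa = perm (Enum-length a a₁ ea ea₁) a a₁
    Pb = perm (Enum-length b₁ b eb₁ eb) b₁ b
    Pc = perm (Enum-length c c₁ ec ec₁) c c₁
    Pd = perm (Enum-length d₁ d ed₁ ed) d₁ d

  η-preserves-σ : ∀ m n {A} (a : Vec ℕ m) (c : Vec ℕ n) {e e′} →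
                  ORD≈ NomS (η (σ m n)) (⟨ a ++ c ] NomS.id A [ c ++ a ⟩ {e} {e′})
  η-preserves-σ m n {A} a c {e} {e′} = η-by-decode (⟨ a ++ c ] NomS.id A [ c ++ a ⟩ {e} {e′}) (begin
    perm (Enum-length ac E e eE) ac E ⨾ (id _ ⨾ perm (Enum-length E ca eE e′) E ca) ≈⟨ ⨾-congˡ (idˡ _) ⟩
    perm (Enum-length ac E e eE) ac E ⨾ perm (Enum-length E ca eE e′) E ca
      ≈⟨ perm-trans-Enum ac E ca e eE e′
                         (Enum-length ac E e eE) (Enum-length E ca eE e′) (Enum-length ac ca e e′) ⟩
    perm (Enum-length ac ca e e′) ac ca ≈⟨ σ≈perm a c (Enum-length ac ca e e′) (Enum⇒Distinct ac e) ⟨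
    σ m n                               ∎)
    where
    E = enum A
    eE = enum-Enum A
    ac = a ++ c
    ca = c ++ a

  η-isIso : IsPROPIsoToORD NomS S η
  η-isIso = record
    { η-cong       = λ f≈g → ord-mid (nom-mid f≈g)
    ; η-injective  = λ {_} {_} {f} {g} ηf≈ηg → ≈.trans (decode-resp-η ηf≈ηg) (decode-η g)
    ; η-surjective = λ h → decode h , ord-sym (η-decode h)
    ; η-id         = η-preserves-id
    ; η-⨾          = η-preserves-⨾
    ; η-⊕          = η-preserves-⊕
    ; η-σ          = η-preserves-σ
    }

mainTheorem13 : ∀ {c ℓ : Level} →
    Σ (∀ (S : PROP c ℓ) {n m} → PROP.Hom S n m → ORDHom (NOM S) n m) λ η →
      -- η_S is an isomorphism of PROPs S → ORD(NOM(S))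
      ((S : PROP c ℓ) → IsPROPIsoToORD (NOM S) S (η S))
      -- natural in S
      × (∀ (S S' : PROP c ℓ) (F : ∀ {n m} → PROP.Hom S n m → PROP.Hom S' n m) →
           IsPROPMorphism S S' F →
           ∀ {n m} (f : PROP.Hom S n m) →
           ORD≈ (NOM S') (ORD₁ (NOM₁ F) (η S f)) (η S' (F f)))
      -- f ↦ ⟨a][a⟩f⟨b][b⟩ for some lists a, b of pairwise distinct names
      × (∀ (S : PROP c ℓ) {n m} (f : PROP.Hom S n m) →
           Σ (Vec ℕ n) λ a → Σ (Vec ℕ m) λ b →
           Σ (n ≡ card (set a)) λ pa → Σ (m ≡ card (set b)) λ pb →
           ORD≈ (NOM S) (η S f)
             (⟨ a ] [ a ⟩ f ⟨ b ] {refl , pa} {refl , pb} [ b ⟩ {refl , pa} {refl , pb}))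
-- Naturality and the shape of η hold on the nose: ORD₁ (NOM₁ F) (η f) is the term η (F f).
mainTheorem13 =
  (λ S → Representation.η S) ,
  (λ S → Representation.η-isIso S) ,
  (λ S S′ F _ f → ord-refl) ,
  (λ S {n} {m} f → standardNames n , standardNames m ,
                   length≡card-standardNames n , length≡card-standardNames m , ord-refl)
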